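{- Let $A$ be a symmetric $n\times n$ integer matrix all of whose diagonal entries are even, and let $\overline A=A\pmod 2$. Then: (1) $\det(A)\equiv\pm1\pmod 4$ if and only if $\overline A$ has rank $n$ over $\mathbb F_2$ (i.e. $\dim\overline V_0=0$); (2) $\det(A)\equiv 2\pmod 4$ if and only if $n$ is odd, the rank of $\overline A$ is $n-1$ and $q(\overline V_0)=\mathbb F_2$ (i.e. $\dim\overline V_0=1$ and $\dim\overline V_{00}=0$); (3) $\det(A)\equiv 0\pmod 4$ if and only if $\dim\overline V_{00}\ge 1$. In particular, if the rank of $\overline A$ is at most $n-2$, then $\det(A)\equiv 0\pmod 4$. Furthermore, if $n\equiv 0\pmod 4$ then $\det(A)\equiv 1\pmod 4$ when $\overline A$ has rank $n$ and $\det(A)\equiv 0\pmod 4$ when the rank is less than $n$; if $n\equiv 2\pmod 4$ then $\det(A)\equiv -1\pmod 4$ when $\overline A$ has rank $n$ and $\det(A)\equiv 0\pmod 4$ when the rank is less than $n$.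
   Context: Let $V=\mathbb Z^n$, $\overline V=\mathbb Z^n/2\mathbb Z^n$, and $(v,w)=v^TAw$. The quadratic form $q:\overline V\to\mathbb F_2$ is $q(v)=(v,v)/2\bmod 2$. Define $V_0=\{v\in V:(v,w)\equiv 0\pmod 2\ \forall w\in V\}$, $V_{00}=\{v\in V_0:(v,v)\equiv 0\pmod 4\}$, and the $\mathbb F_2$-spaces $\overline V_0=V_0/2V$ (the kernel of $\overline A$ acting on $\overline V$) and $\overline V_{00}=V_{00}/2V=\{v\in\overline V_0: q(v)=0\}$. -}

module Defs where

open import Data.Bool using (Bool; true; false; not; _∧_; _∨_; _xor_; if_then_else_)
open import Data.Nat as ℕ using (ℕ; zero; suc; _%_; _/_; _≡ᵇ_)
open import Data.Integer as ℤ using (ℤ; +_; _+_; _*_; _-_; -1ℤ; 0ℤ; 1ℤ; ∣_∣)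
open import Data.Integer.Divisibility using (_∣_)
open import Data.Fin using (Fin; zero; suc; toℕ; punchIn)
open import Data.List using (List; []; _∷_; _++_; map; filterᵇ; length)
open import Data.Bool.ListAction using (any)
import Data.Vec.Functional as VF
open import Relation.Binary.PropositionalEquality using (_≡_)

-- n×n integer matrices and vectors over F₂ (Bool, with xor as addition)
Mat : ℕ → Set
Mat n = Fin n → Fin n → ℤ

Vec₂ : ℕ → Set
Vec₂ n = Fin n → Bool

Symmetric : ∀ {n} → Mat n → Set
Symmetric A = ∀ i j → A i j ≡ A j i

EvenDiagonal : ∀ {n} → Mat n → Set
EvenDiagonal A = ∀ i → + 2 ∣ A i i

_≡_[mod_] : ℤ → ℤ → ℕ → Set
a ≡ b [mod m ] = + m ∣ (a - b)

sumℤ : ∀ {n} → (Fin n → ℤ) → ℤ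
sumℤ {zero}  f = 0ℤ
sumℤ {suc n} f = f zero + sumℤ (λ i → f (suc i))

det : ∀ {n} → Mat n → ℤ
det {zero}  A = 1ℤ
det {suc n} A = sumℤ (λ j → (-1ℤ ℤ.^ toℕ j) * A zero j * det (λ i k → A (suc i) (punchIn j k)))

bit : ℤ → Bool
bit z = (∣ z ∣ % 2) ≡ᵇ 1

Abar : ∀ {n} → Mat n → Fin n → Fin n → Bool
Abar A i j = bit (A i j)

xorSum : ∀ {n} → (Fin n → Bool) → Bool
xorSum {zero}  f = false
xorSum {suc n} f = f zero xor xorSum (λ i → f (suc i))

allᵇ : ∀ {n} → (Fin n → Bool) → Bool
allᵇ {zero}  f = true
allᵇ {suc n} f = f zero ∧ allᵇ (λ i → f (suc i))

applyBar : ∀ {n} → Mat n → Vec₂ n → Vec₂ n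
applyBar A v i = xorSum (λ j → Abar A i j ∧ v j)

isZero : ∀ {n} → Vec₂ n → Bool
isZero v = allᵇ (λ i → not (v i))

eqᵇ : ∀ {n} → Vec₂ n → Vec₂ n → Bool
eqᵇ v w = allᵇ (λ i → not (v i xor w i))

allVecs : ∀ n → List (Vec₂ n)
allVecs zero    = (λ ()) ∷ []
allVecs (suc n) = map (false VF.∷_) (allVecs n) ++ map (true VF.∷_) (allVecs n)

form : ∀ {n} → Mat n → (Fin n → ℤ) → (Fin n → ℤ) → ℤ
form A v w = sumℤ (λ i → sumℤ (λ j → v i * A i j * w j))

lift : ∀ {n} → Vec₂ n → Fin n → ℤ
lift v i = if v i then 1ℤ else 0ℤ

q : ∀ {n} → Mat n → Vec₂ n → Bool
q A v = ((∣ form A (lift v) (lift v) ∣ / 2) % 2) ≡ᵇ 1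

InV0 : ∀ {n} → Mat n → Vec₂ n → Bool
InV0 A v = isZero (applyBar A v)

V0bar : ∀ {n} → Mat n → List (Vec₂ n)
V0bar {n} A = filterᵇ (InV0 A) (allVecs n)

V00bar : ∀ {n} → Mat n → List (Vec₂ n)
V00bar {n} A = filterᵇ (λ v → InV0 A v ∧ not (q A v)) (allVecs n)

ImBar : ∀ {n} → Mat n → List (Vec₂ n)
ImBar {n} A = filterᵇ (λ w → any (λ v → eqᵇ (applyBar A v) w) (allVecs n)) (allVecs n)

-- an F₂-subspace W (given by its list of elements) has dimension k iff |W| = 2ᵏ
HasDim : ∀ {n} → List (Vec₂ n) → ℕ → Set
HasDim W k = length W ≡ 2 ℕ.^ k

HasRank : ∀ {n} → Mat n → ℕ → Set
HasRank A r = HasDim (ImBar A) r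

{-# OPTIONS --safe #-}
module Submission where

-- If the first row of A is even, expanding det A along it gives
-- det A ≡ A₀₀ · det C (mod 4) for the minor C, V̄₀(A) = F₂ ⊕ V̄₀(C), and the new basis vector has
-- q = A₀₀/2 mod 2.  Otherwise some A₀ⱼ is odd; after swapping coordinates 1 and j, the top-left
-- 2×2 block P has determinant δ ≡ -1 (mod 4).  Adding multiples of the first two columns, given
-- by -δ · adj(P), to the others clears the first two rows modulo 4 and leaves an integral Schur
-- complement C with det A ≡ δ · det C ≡ -det C (mod 4), while x ↦ (r₁·x, r₀·x, x), with rᵢ row i
-- to the right of P, maps V̄₀(C) bijectively onto V̄₀(A) and preserves q.  The three shapes
-- "V̄₀ = 0", "V̄₀ a line on which q ≠ 0" and "V̄₀₀ ≠ 0", with determinants ±1, 2 and 0 mod 4,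
-- are thus propagated from C to A; rank–nullity over F₂ turns dim V̄₀ into the rank of Ā.

module Arithmetic where

  open import Defs
  open import Data.Bool using (Bool; true; false; _∧_; _xor_; if_then_else_)
  import Data.Bool.Properties as BoolP
  open import Data.Empty using (⊥-elim)
  open import Data.Fin using (Fin; zero; suc)
  import Data.Fin.Permutation as Perm
  import Data.Fin.Permutation.Components as PC
  import Data.Fin.Properties as FinP
  open import Data.Integer using (ℤ; +_; -[1+_]; 0ℤ; 1ℤ; _+_; _*_; -_; _-_; ∣_∣)
  open import Data.Integer.Divisibility using (_∣_)
  open import Data.Integer.Divisibility.Signed as Signed
    using (∣ᵤ⇒∣; ∣⇒∣ᵤ; divides; ∣m∣n⇒∣m+n; ∣m⇒∣m*n; ∣n⇒∣m*n; ∣m⇒∣-m)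
  import Data.Integer.Properties as ℤP
  open import Data.Integer.Tactic.RingSolver using (solve-∀)
  open import Algebra.Properties.Semiring.Sum ℤP.+-*-semiring
    using (sum; sum-cong-≗; ∑-distrib-+; ∑-comm; *-distribˡ-sum; sum-permute)
  open import Data.Nat as ℕ using (ℕ; zero; suc)
  import Data.Nat.Divisibility as ℕ∣
  import Data.Nat.Properties as ℕP
  open import Data.Product using (∃; _,_)
  open import Function using (_∘_)
  open import Relation.Binary.Bundles using (Setoid)
  open import Relation.Binary.PropositionalEquality
  import Relation.Binary.Reasoning.Setoid as SetoidReasoning
  open import Relation.Binary.Structures using (IsEquivalence)
  open import Relation.Nullary using (¬_)

  private
    variable
      n m m′ : ℕ
      a a′ b b′ c : ℤ
      f g : Fin n → ℤ

  sumℤ≡sum : (f : Fin n → ℤ) → sumℤ f ≡ sum f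
  sumℤ≡sum {zero}  f = refl
  sumℤ≡sum {suc n} f = cong (_+_ (f zero)) (sumℤ≡sum (f ∘ suc))

  sumℤ-cong : (∀ i → f i ≡ g i) → sumℤ f ≡ sumℤ g
  sumℤ-cong {f = f} {g} f≗g = begin
    sumℤ f ≡⟨ sumℤ≡sum f ⟩
    sum f  ≡⟨ sum-cong-≗ f≗g ⟩
    sum g  ≡⟨ sumℤ≡sum g ⟨
    sumℤ g ∎
    where
    open ≡-Reasoning

  sumℤ-distrib-+ : (f g : Fin n → ℤ) → sumℤ (λ i → f i + g i) ≡ sumℤ f + sumℤ g
  sumℤ-distrib-+ f g = begin
    sumℤ (λ i → f i + g i) ≡⟨ sumℤ≡sum (λ i → f i + g i) ⟩
    sum (λ i → f i + g i)  ≡⟨ ∑-distrib-+ f g ⟩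
    sum f + sum g          ≡⟨ cong₂ _+_ (sumℤ≡sum f) (sumℤ≡sum g) ⟨
    sumℤ f + sumℤ g        ∎
    where
    open ≡-Reasoning

  sumℤ-*ˡ : (c : ℤ) (f : Fin n → ℤ) → sumℤ (λ i → c * f i) ≡ c * sumℤ f
  sumℤ-*ˡ c f = begin
    sumℤ (λ i → c * f i) ≡⟨ sumℤ≡sum (λ i → c * f i) ⟩
    sum (λ i → c * f i)  ≡⟨ *-distribˡ-sum c f ⟨
    c * sum f            ≡⟨ cong (c *_) (sumℤ≡sum f) ⟨
    c * sumℤ f           ∎
    where
    open ≡-Reasoning

  sumℤ-*ʳ : (f : Fin n → ℤ) (c : ℤ) → sumℤ (λ i → f i * c) ≡ sumℤ f * c
  sumℤ-*ʳ f c = trans (sumℤ-cong λ i → ℤP.*-comm (f i) c) (trans (sumℤ-*ˡ c f) (ℤP.*-comm c (sumℤ f)))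

  sumℤ-linear : (a b : ℤ) (f g : Fin n → ℤ) → sumℤ (λ i → a * f i + b * g i) ≡ a * sumℤ f + b * sumℤ g
  sumℤ-linear a b f g = trans (sumℤ-distrib-+ (λ i → a * f i) (λ i → b * g i)) (cong₂ _+_ (sumℤ-*ˡ a f) (sumℤ-*ˡ b g))

  sumℤ-comm : ∀ {n′} (f : Fin n → Fin n′ → ℤ) →
    sumℤ (λ i → sumℤ (λ j → f i j)) ≡ sumℤ (λ j → sumℤ (λ i → f i j))
  sumℤ-comm f = begin
    sumℤ (λ i → sumℤ (f i))                ≡⟨ sumℤ≡sum (λ i → sumℤ (f i)) ⟩
    sum (λ i → sumℤ (f i))                 ≡⟨ sum-cong-≗ (λ i → sumℤ≡sum (f i)) ⟩
    sum (λ i → sum (f i))                  ≡⟨ ∑-comm f ⟩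
    sum (λ j → sum (λ i → f i j))          ≡⟨ sum-cong-≗ (λ j → sumℤ≡sum (λ i → f i j)) ⟨
    sum (λ j → sumℤ (λ i → f i j))         ≡⟨ sumℤ≡sum (λ j → sumℤ (λ i → f i j)) ⟨
    sumℤ (λ j → sumℤ (λ i → f i j))        ∎
    where
    open ≡-Reasoning

  sumℤ-transpose : (c d : Fin n) (f : Fin n → ℤ) → sumℤ (λ i → f (PC.transpose c d i)) ≡ sumℤ f
  sumℤ-transpose c d f = begin
    sumℤ (λ i → f (PC.transpose c d i))   ≡⟨ sumℤ≡sum (λ i → f (PC.transpose c d i)) ⟩
    sum (λ i → f (PC.transpose c d i))    ≡⟨ sum-permute f (Perm.transpose c d) ⟨
    sum f                                 ≡⟨ sumℤ≡sum f ⟨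
    sumℤ f                                ∎
    where
    open ≡-Reasoning

  sumℤ-zero : (∀ i → f i ≡ 0ℤ) → sumℤ f ≡ 0ℤ
  sumℤ-zero {zero}  _   = refl
  sumℤ-zero {suc n} f≗0 = cong₂ _+_ (f≗0 zero) (sumℤ-zero (f≗0 ∘ suc))

  sumℤ-single : (f : Fin n → ℤ) (d : Fin n) → (∀ l → l ≢ d → f l ≡ 0ℤ) → sumℤ f ≡ f d
  sumℤ-single {suc n} f zero    others =
    trans (cong (_+_ (f zero)) (sumℤ-zero λ l → others (suc l) λ ())) (ℤP.+-identityʳ (f zero))
  sumℤ-single {suc n} f (suc d) others =
    trans (cong (λ t → t + sumℤ (f ∘ suc)) (others zero λ ()))
          (trans (ℤP.+-identityˡ (sumℤ (f ∘ suc)))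
                 (sumℤ-single (f ∘ suc) d λ l l≢d → others (suc l) (l≢d ∘ FinP.suc-injective)))

  sumℤ-pair : (f : Fin n → ℤ) (c d : Fin n) → c ≢ d → (∀ l → l ≢ c → l ≢ d → f l ≡ 0ℤ) →
    sumℤ f ≡ f c + f d
  sumℤ-pair {suc n} f zero zero c≢d _ = ⊥-elim (c≢d refl)
  sumℤ-pair {suc n} f zero (suc d) _ others =
    cong (_+_ (f zero)) (sumℤ-single (f ∘ suc) d λ l l≢d → others (suc l) (λ ()) (l≢d ∘ FinP.suc-injective))
  sumℤ-pair {suc n} f (suc c) zero _ others =
    trans (cong (_+_ (f zero)) (sumℤ-single (f ∘ suc) c λ l l≢c → others (suc l) (l≢c ∘ FinP.suc-injective) (λ ())))
          (ℤP.+-comm (f zero) (f (suc c)))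
  sumℤ-pair {suc n} f (suc c) (suc d) c≢d others =
    trans (cong₂ _+_ (others zero (λ ()) (λ ())) (sumℤ-pair (f ∘ suc) c d (c≢d ∘ cong suc)
            λ l l≢c l≢d → others (suc l) (l≢c ∘ FinP.suc-injective) (l≢d ∘ FinP.suc-injective)))
          (ℤP.+-identityˡ (f (suc c) + f (suc d)))

  -- `a ≡ b [mod m ]` unfolds to a divisibility statement about ∣ a - b ∣ in ℕ, from
  -- which Agda cannot recover a and b; this record keeps them inferable.
  infix 4 _≡_⟨mod_⟩
  record _≡_⟨mod_⟩ (a b : ℤ) (m : ℕ) : Set where
    constructor ⟨_⟩
    field difference-divisible : + m Signed.∣ (a - b)

  fromMod : a ≡ b [mod m ] → a ≡ b ⟨mod m ⟩
  fromMod a≡b = ⟨ ∣ᵤ⇒∣ a≡b ⟩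

  toMod : a ≡ b ⟨mod m ⟩ → a ≡ b [mod m ]
  toMod ⟨ m∣a-b ⟩ = ∣⇒∣ᵤ m∣a-b

  private
    via : ∀ {e} → a - b ≡ e → + m Signed.∣ e → a ≡ b ⟨mod m ⟩
    via a-b≡e m∣e = ⟨ subst (Signed._∣_ _) (sym a-b≡e) m∣e ⟩

  mod-reflexive : a ≡ b → a ≡ b ⟨mod m ⟩
  mod-reflexive {a = a} refl = via (ℤP.+-inverseʳ a) (divides 0ℤ refl)

  mod-refl : a ≡ a ⟨mod m ⟩
  mod-refl = mod-reflexive refl

  mod-sym : a ≡ b ⟨mod m ⟩ → b ≡ a ⟨mod m ⟩
  mod-sym {a = a} {b = b} ⟨ m∣a-b ⟩ = via (swap a b) (∣m⇒∣-m m∣a-b)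
    where
    swap : ∀ a b → b - a ≡ - (a - b)
    swap = solve-∀

  mod-trans : a ≡ b ⟨mod m ⟩ → b ≡ c ⟨mod m ⟩ → a ≡ c ⟨mod m ⟩
  mod-trans {a = a} {b = b} {c = c} ⟨ m∣a-b ⟩ ⟨ m∣b-c ⟩ = via (split a b c) (∣m∣n⇒∣m+n m∣a-b m∣b-c)
    where
    split : ∀ a b c → a - c ≡ (a - b) + (b - c)
    split = solve-∀

  mod-isEquivalence : IsEquivalence (λ a b → a ≡ b ⟨mod m ⟩)
  mod-isEquivalence = record { refl = mod-refl ; sym = mod-sym ; trans = mod-trans }

  mod-setoid : ℕ → Setoid _ _
  mod-setoid m = record { isEquivalence = mod-isEquivalence {m = m} }

  module ≡-mod-Reasoning (m : ℕ) = SetoidReasoning (mod-setoid m)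

  mod-+ : a ≡ a′ ⟨mod m ⟩ → b ≡ b′ ⟨mod m ⟩ → a + b ≡ a′ + b′ ⟨mod m ⟩
  mod-+ {a = a} {a′ = a′} {b = b} {b′ = b′} ⟨ m∣a-a′ ⟩ ⟨ m∣b-b′ ⟩ =
    via (split a a′ b b′) (∣m∣n⇒∣m+n m∣a-a′ m∣b-b′)
    where
    split : ∀ a a′ b b′ → (a + b) - (a′ + b′) ≡ (a - a′) + (b - b′)
    split = solve-∀

  mod-* : a ≡ a′ ⟨mod m ⟩ → b ≡ b′ ⟨mod m ⟩ → a * b ≡ a′ * b′ ⟨mod m ⟩
  mod-* {a = a} {a′ = a′} {b = b} {b′ = b′} ⟨ m∣a-a′ ⟩ ⟨ m∣b-b′ ⟩ =
    via (split a a′ b b′) (∣m∣n⇒∣m+n (∣n⇒∣m*n a m∣b-b′) (∣m⇒∣m*n b′ m∣a-a′))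
    where
    split : ∀ a a′ b b′ → a * b - a′ * b′ ≡ a * (b - b′) + (a - a′) * b′
    split = solve-∀

  mod-neg : a ≡ a′ ⟨mod m ⟩ → - a ≡ - a′ ⟨mod m ⟩
  mod-neg {a = a} {a′ = a′} ⟨ m∣a-a′ ⟩ = via (split a a′) (∣m⇒∣-m m∣a-a′)
    where
    split : ∀ a a′ → - a - - a′ ≡ - (a - a′)
    split = solve-∀

  mod-sumℤ : (∀ i → f i ≡ g i ⟨mod m ⟩) → sumℤ f ≡ sumℤ g ⟨mod m ⟩
  mod-sumℤ {zero}  _   = mod-refl
  mod-sumℤ {suc n} f≡g = mod-+ (f≡g zero) (mod-sumℤ (f≡g ∘ suc))

  mod-by : (k : ℤ) → a ≡ b + k * + m → a ≡ b ⟨mod m ⟩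
  mod-by {b = b} {m = m} k refl = via (cancel b k (+ m)) (divides k refl)
    where
    cancel : ∀ b k m → b + k * m - b ≡ k * m
    cancel = solve-∀

  mod-quotient : a ≡ b ⟨mod m ⟩ → ∃ λ k → a ≡ b + k * + m
  mod-quotient {a = a} {b = b} ⟨ divides k a-b≡km ⟩ = k , trans (split a b) (cong (_+_ b) a-b≡km)
    where
    split : ∀ a b → a ≡ b + (a - b)
    split = solve-∀

  mod-*ʳ : a ≡ b ⟨mod m ⟩ → ∀ k → a * + k ≡ b * + k ⟨mod m ℕ.* k ⟩
  mod-*ʳ {a = a} {b = b} {m = m} ⟨ divides c a-b≡cm ⟩ k = ⟨ divides c (begin
    a * + k - b * + k      ≡⟨ factor a b (+ k) ⟩
    (a - b) * + k          ≡⟨ cong (_* + k) a-b≡cm ⟩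
    c * + m * + k          ≡⟨ ℤP.*-assoc c (+ m) (+ k) ⟩
    c * (+ m * + k)        ≡⟨ cong (c *_) (ℤP.pos-* m k) ⟨
    c * + (m ℕ.* k)        ∎) ⟩
    where
    open ≡-Reasoning
    factor : ∀ a b k → a * k - b * k ≡ (a - b) * k
    factor = solve-∀

  mod-*-zero : a ≡ 0ℤ ⟨mod m ⟩ → b ≡ 0ℤ ⟨mod m′ ⟩ → a * b ≡ 0ℤ ⟨mod m ℕ.* m′ ⟩
  mod-*-zero {a = a} {m = m} {b = b} {m′ = m′} ⟨ divides k a-0≡km ⟩ ⟨ divides l b-0≡lm′ ⟩ =
    ⟨ divides (k * l) (begin
      a * b - 0ℤ                  ≡⟨ drop-zeros a b ⟩
      (a - 0ℤ) * (b - 0ℤ)         ≡⟨ cong₂ _*_ a-0≡km b-0≡lm′ ⟩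
      (k * + m) * (l * + m′)      ≡⟨ regroup k l (+ m) (+ m′) ⟩
      k * l * (+ m * + m′)        ≡⟨ cong (k * l *_) (ℤP.pos-* m m′) ⟨
      k * l * + (m ℕ.* m′)        ∎) ⟩
    where
    open ≡-Reasoning
    drop-zeros : ∀ a b → a * b - 0ℤ ≡ (a - 0ℤ) * (b - 0ℤ)
    drop-zeros = solve-∀
    regroup : ∀ k l m m′ → (k * m) * (l * m′) ≡ k * l * (m * m′)
    regroup = solve-∀

  ¬mod-small : .{{_ : ℕ.NonZero ∣ a - b ∣}} → ∣ a - b ∣ ℕ.< m → ¬ (a ≡ b ⟨mod m ⟩)
  ¬mod-small small a≡b = ℕP.<⇒≱ small (ℕ∣.∣⇒≤ (toMod a≡b))

  toℤ : Bool → ℤ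
  toℤ b = if b then 1ℤ else 0ℤ

  -x≡x⟨mod2⟩ : ∀ x → - x ≡ x ⟨mod 2 ⟩
  -x≡x⟨mod2⟩ x = mod-by (- x) (twice x)
    where
    twice : ∀ x → - x ≡ x + (- x) * + 2
    twice = solve-∀

  bit-parity : ∀ z → z ≡ toℤ (bit z) ⟨mod 2 ⟩
  bit-parity (+ n)    = parity-ℕ n
    where
    parity-ℕ : ∀ n → + n ≡ toℤ (bit (+ n)) ⟨mod 2 ⟩
    parity-ℕ 0             = mod-refl
    parity-ℕ 1             = mod-refl
    parity-ℕ (suc (suc n)) = mod-trans (mod-by 1ℤ (cong +_ (ℕP.+-comm 2 n))) (parity-ℕ n)
  bit-parity -[1+ n ] = mod-trans (-x≡x⟨mod2⟩ (+ suc n)) (bit-parity (+ suc n))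

  toℤ-injective-mod2 : ∀ {b c} → toℤ b ≡ toℤ c ⟨mod 2 ⟩ → b ≡ c
  toℤ-injective-mod2 {false} {false} _   = refl
  toℤ-injective-mod2 {false} {true}  0≡1 = ⊥-elim (¬mod-small ℕP.≤-refl 0≡1)
  toℤ-injective-mod2 {true}  {false} 1≡0 = ⊥-elim (¬mod-small ℕP.≤-refl 1≡0)
  toℤ-injective-mod2 {true}  {true}  _   = refl

  bit-unique : ∀ {z b} → z ≡ toℤ b ⟨mod 2 ⟩ → bit z ≡ b
  bit-unique {z} z≡b = toℤ-injective-mod2 (mod-trans (mod-sym (bit-parity z)) z≡b)

  bit-cong : a ≡ b ⟨mod 2 ⟩ → bit a ≡ bit b
  bit-cong {b = b} a≡b = bit-unique (mod-trans a≡b (bit-parity b))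

  bit-toℤ : ∀ b → bit (toℤ b) ≡ b
  bit-toℤ false = refl
  bit-toℤ true  = refl

  bit-+ : ∀ a b → bit (a + b) ≡ bit a xor bit b
  bit-+ a b = bit-unique (mod-trans (mod-+ (bit-parity a) (bit-parity b)) (toℤ-xor (bit a) (bit b)))
    where
    toℤ-xor : ∀ x y → toℤ x + toℤ y ≡ toℤ (x xor y) ⟨mod 2 ⟩
    toℤ-xor false y     = mod-reflexive (ℤP.+-identityˡ (toℤ y))
    toℤ-xor true  false = mod-refl
    toℤ-xor true  true  = mod-by 1ℤ refl

  bit-* : ∀ a b → bit (a * b) ≡ bit a ∧ bit b
  bit-* a b = bit-unique (mod-trans (mod-* (bit-parity a) (bit-parity b)) (mod-reflexive (toℤ-∧ (bit a) (bit b))))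
    where
    toℤ-∧ : ∀ x y → toℤ x * toℤ y ≡ toℤ (x ∧ y)
    toℤ-∧ false y     = refl
    toℤ-∧ true  false = refl
    toℤ-∧ true  true  = refl

  bit-neg : ∀ a → bit (- a) ≡ bit a
  bit-neg a = bit-cong (-x≡x⟨mod2⟩ a)

  bit-minus : ∀ a b → bit (a - b) ≡ bit a xor bit b
  bit-minus a b = trans (bit-+ a (- b)) (cong (bit a xor_) (bit-neg b))

  bit-sumℤ : (f : Fin n → ℤ) → bit (sumℤ f) ≡ xorSum (bit ∘ f)
  bit-sumℤ {zero}  f = refl
  bit-sumℤ {suc n} f = trans (bit-+ (f zero) (sumℤ (f ∘ suc))) (cong (bit (f zero) xor_) (bit-sumℤ (f ∘ suc)))

  bit≡false⇒even : bit a ≡ false → a ≡ 0ℤ ⟨mod 2 ⟩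
  bit≡false⇒even {a} bit≡0 = subst (λ b → a ≡ toℤ b ⟨mod 2 ⟩) bit≡0 (bit-parity a)

  bit≡true⇒odd : bit a ≡ true → a ≡ 1ℤ ⟨mod 2 ⟩
  bit≡true⇒odd {a} bit≡1 = subst (λ b → a ≡ toℤ b ⟨mod 2 ⟩) bit≡1 (bit-parity a)

  even-quotient : ∀ a → + 2 ∣ a → ∃ λ α → a ≡ α * + 2
  even-quotient a 2∣a with ∣ᵤ⇒∣ 2∣a
  ... | divides α a≡2α = α , a≡2α

  even⇒bit≡false : ∀ a → + 2 ∣ a → bit a ≡ false
  even⇒bit≡false a 2∣a with α , a≡2α ← even-quotient a 2∣a =
    bit-unique {z = a} (mod-by α (trans a≡2α (sym (ℤP.+-identityˡ (α * + 2)))))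

  bit-binaryQuadratic : ∀ g b a x y →
    bit (g * (x * x) - b * (x * y) + a * (y * y)) ≡ ((bit g ∧ bit x) xor (bit b ∧ (bit x ∧ bit y))) xor (bit a ∧ bit y)
  bit-binaryQuadratic g b a x y = begin
    bit (g * (x * x) - b * (x * y) + a * (y * y))
      ≡⟨ trans (bit-+ (g * (x * x) - b * (x * y)) (a * (y * y)))
               (cong (_xor bit (a * (y * y))) (bit-minus (g * (x * x)) (b * (x * y)))) ⟩
    (bit (g * (x * x)) xor bit (b * (x * y))) xor bit (a * (y * y))
      ≡⟨ cong₂ (λ p r → (p xor bit (b * (x * y))) xor r) (bit-square g x) (bit-square a y) ⟩
    ((bit g ∧ bit x) xor bit (b * (x * y))) xor (bit a ∧ bit y)
      ≡⟨ cong (λ p → ((bit g ∧ bit x) xor p) xor (bit a ∧ bit y))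
              (trans (bit-* b (x * y)) (cong (bit b ∧_) (bit-* x y))) ⟩
    ((bit g ∧ bit x) xor (bit b ∧ (bit x ∧ bit y))) xor (bit a ∧ bit y) ∎
    where
    open ≡-Reasoning
    bit-square : ∀ c z → bit (c * (z * z)) ≡ bit c ∧ bit z
    bit-square c z = trans (bit-* c (z * z)) (cong (bit c ∧_) (trans (bit-* z z) (BoolP.∧-idem (bit z))))

module Determinant where

  open import Defs
  open Arithmetic
  open import Data.Bool using (true; false; if_then_else_)
  open import Data.Nat as ℕ using (ℕ; zero; suc; _<ᵇ_)
  import Data.Nat.Properties as ℕP
  open import Data.Integer as ℤ using (ℤ; +_; 0ℤ; 1ℤ; -1ℤ; _+_; _*_; -_; _-_)
  import Data.Integer.Properties as ℤP
  open import Data.Integer.Tactic.RingSolver using (solve-∀)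
  open import Data.Fin as Fin using (Fin; zero; suc; toℕ; inject₁; punchIn; punchOut; _≟_)
  open import Data.Fin.Patterns using (0F; 1F)
  import Data.Fin.Properties as FinP
  import Data.Fin.Permutation.Components as PC
  open import Data.Vec.Functional using (updateAt)
  open import Data.Vec.Functional.Properties using (updateAt-updates; updateAt-minimal)
  open import Data.Empty using (⊥-elim)
  open import Data.Product using (∃; _,_; _×_)
  open import Function using (_∘_)
  open import Relation.Binary.Definitions using (tri<; tri≈; tri>)
  open import Relation.Binary.PropositionalEquality
  open import Relation.Nullary using (yes; no; ¬_)
  open import Relation.Nullary.Decidable using (dec-true; dec-false)

  private
    variable
      n m : ℕ

  minor : Mat (suc n) → Fin (suc n) → Mat n
  minor A j i k = A (suc i) (punchIn j k)

  sign : Fin n → ℤ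
  sign j = -1ℤ ℤ.^ toℕ j

  det-cong : {A B : Mat n} → (∀ i j → A i j ≡ B i j) → det A ≡ det B
  det-cong {zero}  _   = refl
  det-cong {suc n} A≗B = sumℤ-cong λ j →
    cong₂ (λ a d → sign j * a * d) (A≗B zero j) (det-cong λ i k → A≗B (suc i) (punchIn j k))

  AgreeOffColumn : Fin n → Mat n → Mat n → Set
  AgreeOffColumn c A B = ∀ i l → l ≢ c → A i l ≡ B i l

  minor-agreeOff : {A B : Mat (suc n)} {l c : Fin (suc n)} (l≢c : l ≢ c) →
    AgreeOffColumn c A B → AgreeOffColumn (punchOut l≢c) (minor A l) (minor B l)
  minor-agreeOff {l = l} l≢c A≈B i k k≢c′ = A≈B (suc i) (punchIn l k) λ punchIn≡c →
    k≢c′ (FinP.punchIn-injective l k (punchOut l≢c) (trans punchIn≡c (sym (FinP.punchIn-punchOut l≢c))))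

  minor-punchOut : (A : Mat (suc n)) {l c : Fin (suc n)} (l≢c : l ≢ c) →
    ∀ i → minor A l i (punchOut l≢c) ≡ A (suc i) c
  minor-punchOut A l≢c i = cong (A (suc i)) (FinP.punchIn-punchOut l≢c)

  det-linear : (c : Fin n) (t : ℤ) {A B C : Mat n} → AgreeOffColumn c B A → AgreeOffColumn c C A →
    (∀ i → C i c ≡ A i c + t * B i c) → det C ≡ det A + t * det B
  det-linear {suc n} c t {A} {B} {C} B≈A C≈A C-c = begin
    sumℤ (term C)                         ≡⟨ sumℤ-cong expand ⟩
    sumℤ (λ l → term A l + t * term B l)  ≡⟨ sumℤ-distrib-+ (term A) (λ l → t * term B l) ⟩
    det A + sumℤ (λ l → t * term B l)     ≡⟨ cong (_+_ (det A)) (sumℤ-*ˡ t (term B)) ⟩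
    det A + t * det B                     ∎
    where
    open ≡-Reasoning
    term : Mat (suc n) → Fin (suc n) → ℤ
    term M l = sign l * M zero l * det (minor M l)
    linear-entry : ∀ t s a b d → s * (a + t * b) * d ≡ s * a * d + t * (s * b * d)
    linear-entry = solve-∀
    linear-minor : ∀ t s a d d′ → s * a * (d + t * d′) ≡ s * a * d + t * (s * a * d′)
    linear-minor = solve-∀
    expand : ∀ l → term C l ≡ term A l + t * term B l
    expand l with l ≟ c
    ... | yes refl = begin
      sign l * C zero l * det (minor C l)
        ≡⟨ cong₂ (λ a d → sign l * a * d) (C-c zero)
                 (det-cong λ i k → C≈A (suc i) (punchIn l k) (FinP.punchInᵢ≢i l k)) ⟩
      sign l * (A zero l + t * B zero l) * det (minor A l)
        ≡⟨ linear-entry t (sign l) (A zero l) (B zero l) (det (minor A l)) ⟩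
      term A l + t * (sign l * B zero l * det (minor A l))
        ≡⟨ cong (λ d → term A l + t * (sign l * B zero l * d))
                (det-cong λ i k → sym (B≈A (suc i) (punchIn l k) (FinP.punchInᵢ≢i l k))) ⟩
      term A l + t * term B l ∎
    ... | no l≢c = begin
      sign l * C zero l * det (minor C l)
        ≡⟨ cong₂ (λ a d → sign l * a * d) (C≈A zero l l≢c)
                 (det-linear (punchOut l≢c) t (minor-agreeOff l≢c B≈A) (minor-agreeOff l≢c C≈A) minor-c) ⟩
      sign l * A zero l * (det (minor A l) + t * det (minor B l))
        ≡⟨ linear-minor t (sign l) (A zero l) (det (minor A l)) (det (minor B l)) ⟩
      term A l + t * (sign l * A zero l * det (minor B l))
        ≡⟨ cong (λ a → term A l + t * (sign l * a * det (minor B l))) (sym (B≈A zero l l≢c)) ⟩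
      term A l + t * term B l ∎
      where
      minor-c : ∀ i → minor C l i (punchOut l≢c) ≡ minor A l i (punchOut l≢c) + t * minor B l i (punchOut l≢c)
      minor-c i = begin
        minor C l i (punchOut l≢c)       ≡⟨ minor-punchOut C l≢c i ⟩
        C (suc i) c                      ≡⟨ C-c (suc i) ⟩
        A (suc i) c + t * B (suc i) c    ≡⟨ cong₂ (λ a b → a + t * b) (minor-punchOut A l≢c i) (minor-punchOut B l≢c i) ⟨
        minor A l i (punchOut l≢c) + t * minor B l i (punchOut l≢c) ∎

  punchIn-inject₁-self : (c : Fin n) → punchIn (inject₁ c) c ≡ suc c
  punchIn-inject₁-self zero    = refl
  punchIn-inject₁-self (suc c) = cong suc (punchIn-inject₁-self c)

  punchIn-suc-self : (c : Fin n) → punchIn (suc c) c ≡ inject₁ c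
  punchIn-suc-self zero    = refl
  punchIn-suc-self (suc c) = cong suc (punchIn-suc-self c)

  punchIn-inject₁≡punchIn-suc : (c k : Fin n) → k ≢ c → punchIn (inject₁ c) k ≡ punchIn (suc c) k
  punchIn-inject₁≡punchIn-suc zero    zero    k≢c = ⊥-elim (k≢c refl)
  punchIn-inject₁≡punchIn-suc zero    (suc k) _   = refl
  punchIn-inject₁≡punchIn-suc (suc c) zero    _   = refl
  punchIn-inject₁≡punchIn-suc (suc c) (suc k) k≢c = cong suc (punchIn-inject₁≡punchIn-suc c k (k≢c ∘ cong suc))

  punchIn-adjacent : (l : Fin (suc (suc n))) (c : Fin (suc n)) → l ≢ inject₁ c → l ≢ suc c →
    ∃ λ c′ → punchIn l (inject₁ c′) ≡ inject₁ c × punchIn l (suc c′) ≡ suc c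
  punchIn-adjacent zero zero l≢c _ = ⊥-elim (l≢c refl)
  punchIn-adjacent zero (suc c) _ _ = c , refl , refl
  punchIn-adjacent {zero} (suc zero) zero _ l≢c+1 = ⊥-elim (l≢c+1 refl)
  punchIn-adjacent {suc n} (suc zero) zero _ l≢c+1 = ⊥-elim (l≢c+1 refl)
  punchIn-adjacent {suc n} (suc (suc l)) zero _ _ = zero , refl , refl
  punchIn-adjacent {suc n} (suc l) (suc c) l≢c l≢c+1
    with c′ , l[c′]≡c , l[c′+1]≡c+1 ← punchIn-adjacent l c (l≢c ∘ cong suc) (l≢c+1 ∘ cong suc) =
    suc c′ , cong suc l[c′]≡c , cong suc l[c′+1]≡c+1

  det-adjacent-columns : (A : Mat (suc n)) (c : Fin n) → (∀ i → A i (inject₁ c) ≡ A i (suc c)) → det A ≡ 0ℤ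
  det-adjacent-columns {suc n} A c A-cc = begin
    det A                            ≡⟨ sumℤ-pair term (inject₁ c) (suc c) c≢c+1 others ⟩
    term (inject₁ c) + term (suc c)  ≡⟨ cong (_+_ (term (inject₁ c))) cancel ⟩
    term (inject₁ c) - term (inject₁ c) ≡⟨ ℤP.+-inverseʳ (term (inject₁ c)) ⟩
    0ℤ                               ∎
    where
    open ≡-Reasoning
    term : Fin (suc (suc n)) → ℤ
    term l = sign l * A zero l * det (minor A l)
    c≢c+1 : inject₁ c ≢ suc c
    c≢c+1 c≡c+1 = ℕP.1+n≢n (sym (trans (sym (FinP.toℕ-inject₁ c)) (cong toℕ c≡c+1)))
    others : ∀ l → l ≢ inject₁ c → l ≢ suc c → term l ≡ 0ℤ
    others l l≢c l≢c+1 with c′ , l[c′]≡c , l[c′+1]≡c+1 ← punchIn-adjacent l c l≢c l≢c+1 =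
      trans (cong (sign l * A zero l *_) (det-adjacent-columns (minor A l) c′ λ i →
              trans (cong (A (suc i)) l[c′]≡c) (trans (A-cc (suc i)) (cong (A (suc i)) (sym l[c′+1]≡c+1)))))
            (ℤP.*-zeroʳ (sign l * A zero l))
    same-minor : ∀ i k → minor A (suc c) i k ≡ minor A (inject₁ c) i k
    same-minor i k with k ≟ c
    ... | yes refl = trans (cong (A (suc i)) (punchIn-suc-self k))
                           (trans (A-cc (suc i)) (cong (A (suc i)) (sym (punchIn-inject₁-self k))))
    ... | no k≢c = cong (A (suc i)) (sym (punchIn-inject₁≡punchIn-suc c k k≢c))
    flip-sign : ∀ s a d → -1ℤ * s * a * d ≡ - (s * a * d)
    flip-sign = solve-∀
    cancel : term (suc c) ≡ - term (inject₁ c)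
    cancel = begin
      sign (suc c) * A zero (suc c) * det (minor A (suc c))
        ≡⟨ cong₂ (λ s a → s * a * det (minor A (suc c)))
                 (cong (λ k → -1ℤ * (-1ℤ ℤ.^ k)) (sym (FinP.toℕ-inject₁ c))) (sym (A-cc zero)) ⟩
      -1ℤ * sign (inject₁ c) * A zero (inject₁ c) * det (minor A (suc c))
        ≡⟨ cong (λ d → -1ℤ * sign (inject₁ c) * A zero (inject₁ c) * d) (det-cong same-minor) ⟩
      -1ℤ * sign (inject₁ c) * A zero (inject₁ c) * det (minor A (inject₁ c))
        ≡⟨ flip-sign (sign (inject₁ c)) (A zero (inject₁ c)) (det (minor A (inject₁ c))) ⟩
      - term (inject₁ c) ∎

  setColumn : Mat n → Fin n → (Fin n → ℤ) → Mat n
  setColumn A c u i = updateAt (A i) c (λ _ → u i)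

  setColumn-same : (A : Mat n) (c : Fin n) (u : Fin n → ℤ) → ∀ i → setColumn A c u i c ≡ u i
  setColumn-same A c u i = updateAt-updates c (A i)

  setColumn-other : (A : Mat n) (c : Fin n) (u : Fin n → ℤ) → AgreeOffColumn c (setColumn A c u) A
  setColumn-other A c u i l l≢c = updateAt-minimal l c (A i) l≢c

  transpose-matchˡ : (i j : Fin n) → PC.transpose i j i ≡ j
  transpose-matchˡ i j rewrite dec-true (i ≟ i) refl = refl

  transpose-matchʳ : (i j : Fin n) → PC.transpose i j j ≡ i
  transpose-matchʳ i j with j ≟ i
  ... | yes j≡i = j≡i
  ... | no _ rewrite dec-true (j ≟ j) refl = refl

  transpose-other : {i j k : Fin n} → k ≢ i → k ≢ j → PC.transpose i j k ≡ k
  transpose-other {i = i} {j} {k} k≢i k≢j rewrite dec-false (k ≟ i) k≢i | dec-false (k ≟ j) k≢j = refl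

  fin-cases₂ : ∀ {a} {X : Set a} (c d : Fin n) {f g : Fin n → X} → f c ≡ g c → f d ≡ g d →
    (∀ l → l ≢ c → l ≢ d → f l ≡ g l) → ∀ l → f l ≡ g l
  fin-cases₂ c d f≡g-c f≡g-d f≡g-other l with l ≟ c | l ≟ d
  ... | yes refl | _        = f≡g-c
  ... | no _     | yes refl = f≡g-d
  ... | no l≢c   | no l≢d   = f≡g-other l l≢c l≢d

  transpose-involutive : (i j k : Fin n) → PC.transpose i j (PC.transpose i j k) ≡ k
  transpose-involutive i j = fin-cases₂ i j
    (trans (cong (PC.transpose i j) (transpose-matchˡ i j)) (transpose-matchʳ i j))
    (trans (cong (PC.transpose i j) (transpose-matchʳ i j)) (transpose-matchˡ i j))
    (λ k k≢i k≢j → trans (cong (PC.transpose i j) (transpose-other k≢i k≢j)) (transpose-other k≢i k≢j))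

  swapColumns : Mat n → Fin n → Fin n → Mat n
  swapColumns A c d i l = A i (PC.transpose c d l)

  det-swapColumns-of-alternating : {c d : Fin n} → c ≢ d →
    (∀ (M : Mat n) → (∀ i → M i c ≡ M i d) → det M ≡ 0ℤ) →
    ∀ A → det (swapColumns A c d) ≡ - det A
  det-swapColumns-of-alternating {n} {c} {d} c≢d alternating A = solve-for-swap (begin
    0ℤ                                                    ≡⟨ alternating (M x+y x+y) (equal x+y) ⟨
    det (M x+y x+y)                                       ≡⟨ linear-c x+y ⟩
    det (M x x+y) + 1ℤ * det (M y x+y)                    ≡⟨ cong₂ (λ a b → a + 1ℤ * b) (linear-d x) (linear-d y) ⟩
    (det (M x x) + 1ℤ * det (M x y)) + 1ℤ * (det (M y x) + 1ℤ * det (M y y))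
      ≡⟨ cong₂ (λ a b → (a + 1ℤ * det (M x y)) + 1ℤ * (det (M y x) + 1ℤ * b))
               (alternating (M x x) (equal x)) (alternating (M y y) (equal y)) ⟩
    (0ℤ + 1ℤ * det (M x y)) + 1ℤ * (det (M y x) + 1ℤ * 0ℤ)
      ≡⟨ cong₂ (λ a b → (0ℤ + 1ℤ * a) + 1ℤ * (b + 1ℤ * 0ℤ)) (det-cong Mxy≗A) (det-cong Myx≗swap) ⟩
    (0ℤ + 1ℤ * det A) + 1ℤ * (det (swapColumns A c d) + 1ℤ * 0ℤ) ∎)
    where
    open ≡-Reasoning
    x y x+y : Fin n → ℤ
    x i = A i c
    y i = A i d
    x+y i = x i + y i
    M : (Fin n → ℤ) → (Fin n → ℤ) → Mat n
    M u w = setColumn (setColumn A c u) d w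
    M-c : ∀ u w i → M u w i c ≡ u i
    M-c u w i = trans (setColumn-other (setColumn A c u) d w i c c≢d) (setColumn-same A c u i)
    M-d : ∀ u w i → M u w i d ≡ w i
    M-d u w i = setColumn-same (setColumn A c u) d w i
    M-other : ∀ u w i l → l ≢ c → l ≢ d → M u w i l ≡ A i l
    M-other u w i l l≢c l≢d = trans (setColumn-other (setColumn A c u) d w i l l≢d) (setColumn-other A c u i l l≢c)
    equal : ∀ u → ∀ i → M u u i c ≡ M u u i d
    equal u i = trans (M-c u u i) (sym (M-d u u i))
    agree-c : ∀ u u′ w → AgreeOffColumn c (M u w) (M u′ w)
    agree-c u u′ w i l l≢c with l ≟ d
    ... | yes refl = trans (M-d u w i) (sym (M-d u′ w i))
    ... | no l≢d   = trans (M-other u w i l l≢c l≢d) (sym (M-other u′ w i l l≢c l≢d))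
    agree-d : ∀ u w w′ → AgreeOffColumn d (M u w) (M u w′)
    agree-d u w w′ i l l≢d with l ≟ c
    ... | yes refl = trans (M-c u w i) (sym (M-c u w′ i))
    ... | no l≢c   = trans (M-other u w i l l≢c l≢d) (sym (M-other u w′ i l l≢c l≢d))
    sum-as-linear : ∀ a b → a + b ≡ a + 1ℤ * b
    sum-as-linear a b = cong (_+_ a) (sym (ℤP.*-identityˡ b))
    linear-c : ∀ w → det (M x+y w) ≡ det (M x w) + 1ℤ * det (M y w)
    linear-c w = det-linear c 1ℤ (agree-c y x w) (agree-c x+y x w) λ i →
      trans (M-c x+y w i) (trans (sum-as-linear (x i) (y i))
        (cong₂ (λ a b → a + 1ℤ * b) (sym (M-c x w i)) (sym (M-c y w i))))
    linear-d : ∀ u → det (M u x+y) ≡ det (M u x) + 1ℤ * det (M u y)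
    linear-d u = det-linear d 1ℤ (agree-d u y x) (agree-d u x+y x) λ i →
      trans (M-d u x+y i) (trans (sum-as-linear (x i) (y i))
        (cong₂ (λ a b → a + 1ℤ * b) (sym (M-d u x i)) (sym (M-d u y i))))
    Mxy≗A : ∀ i l → M x y i l ≡ A i l
    Mxy≗A i = fin-cases₂ c d (M-c x y i) (M-d x y i) (M-other x y i)
    Myx≗swap : ∀ i l → M y x i l ≡ swapColumns A c d i l
    Myx≗swap i = fin-cases₂ c d
      (trans (M-c y x i) (cong (A i) (sym (transpose-matchˡ c d))))
      (trans (M-d y x i) (cong (A i) (sym (transpose-matchʳ c d))))
      (λ l l≢c l≢d → trans (M-other y x i l l≢c l≢d) (cong (A i) (sym (transpose-other l≢c l≢d))))
    solve-for-swap : ∀ {a b} → 0ℤ ≡ (0ℤ + 1ℤ * a) + 1ℤ * (b + 1ℤ * 0ℤ) → b ≡ - a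
    solve-for-swap {a} {b} eq = trans (isolate a b) (trans (cong (_- a) (sym eq)) (ℤP.+-identityˡ (- a)))
      where
      isolate : ∀ a b → b ≡ ((0ℤ + 1ℤ * a) + 1ℤ * (b + 1ℤ * 0ℤ)) - a
      isolate = solve-∀

  -- Equal columns at distance g + 1 are brought to distance g by one adjacent swap.
  det-equal-columns-at-distance : ∀ g (A : Mat n) (c d : Fin n) → toℕ d ≡ suc (g ℕ.+ toℕ c) →
    (∀ i → A i c ≡ A i d) → det A ≡ 0ℤ
  det-equal-columns-at-distance g A c zero () _
  det-equal-columns-at-distance zero A c (suc e) d≡c+1 A-cd =
    det-adjacent-columns A e λ i → trans (cong (A i) e≡c) (A-cd i)
    where
    e≡c : inject₁ e ≡ c
    e≡c = FinP.toℕ-injective (trans (FinP.toℕ-inject₁ e) (ℕP.suc-injective d≡c+1))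
  det-equal-columns-at-distance {suc n} (suc g) A c (suc e) d≡c+g+2 A-cd = begin
    det A         ≡⟨ ℤP.neg-involutive (det A) ⟨
    - - det A     ≡⟨ cong -_ (det-swapColumns-of-alternating e≢e+1 (λ M → det-adjacent-columns M e) A) ⟨
    - det B       ≡⟨ cong -_ (det-equal-columns-at-distance g B c (inject₁ e) e≡c+g+1 B-ce) ⟩
    0ℤ            ∎
    where
    open ≡-Reasoning
    B : Mat (suc n)
    B = swapColumns A (inject₁ e) (suc e)
    e≡c+g+1 : toℕ (inject₁ e) ≡ suc (g ℕ.+ toℕ c)
    e≡c+g+1 = trans (FinP.toℕ-inject₁ e) (ℕP.suc-injective d≡c+g+2)
    e≢e+1 : inject₁ e ≢ suc e
    e≢e+1 e≡e+1 = ℕP.1+n≢n (sym (trans (sym (FinP.toℕ-inject₁ e)) (cong toℕ e≡e+1)))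
    c≢e : c ≢ inject₁ e
    c≢e c≡e = ℕP.m≢1+n+m (toℕ c) (trans (cong toℕ c≡e) e≡c+g+1)
    c≢e+1 : c ≢ suc e
    c≢e+1 c≡e+1 = ℕP.m≢1+n+m (toℕ c) (trans (cong toℕ c≡e+1) d≡c+g+2)
    B-ce : ∀ i → B i c ≡ B i (inject₁ e)
    B-ce i = begin
      A i (PC.transpose (inject₁ e) (suc e) c) ≡⟨ cong (A i) (transpose-other c≢e c≢e+1) ⟩
      A i c                                     ≡⟨ A-cd i ⟩
      A i (suc e)                               ≡⟨ cong (A i) (transpose-matchˡ (inject₁ e) (suc e)) ⟨
      A i (PC.transpose (inject₁ e) (suc e) (inject₁ e)) ∎

  gap : ∀ {a b} → a ℕ.< b → b ≡ suc ((b ℕ.∸ suc a) ℕ.+ a)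
  gap {a} {b} a<b = sym (trans (sym (ℕP.+-suc (b ℕ.∸ suc a) a)) (ℕP.m∸n+n≡m a<b))

  det-equal-columns : (A : Mat n) {c d : Fin n} → c ≢ d → (∀ i → A i c ≡ A i d) → det A ≡ 0ℤ
  det-equal-columns A {c} {d} c≢d A-cd with ℕP.<-cmp (toℕ c) (toℕ d)
  ... | tri< c<d _ _ = det-equal-columns-at-distance _ A c d (gap c<d) A-cd
  ... | tri≈ _ c≡d _ = ⊥-elim (c≢d (FinP.toℕ-injective c≡d))
  ... | tri> _ _ d<c = det-equal-columns-at-distance _ A d c (gap d<c) (sym ∘ A-cd)

  det-swapColumns : (A : Mat n) {c d : Fin n} → c ≢ d → det (swapColumns A c d) ≡ - det A
  det-swapColumns A c≢d = det-swapColumns-of-alternating c≢d (λ M → det-equal-columns M c≢d) A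

  det-addColumnMultiple : {A B : Mat n} {k c : Fin n} (t : ℤ) → k ≢ c → AgreeOffColumn k B A →
    (∀ i → B i k ≡ A i k + t * A i c) → det B ≡ det A
  det-addColumnMultiple {A = A} {B} {k} {c} t k≢c B≈A B-k = begin
    det B                  ≡⟨ det-linear k t (setColumn-other A k (λ i → A i c)) B≈A B-k′ ⟩
    det A + t * det A′     ≡⟨ cong (λ d → det A + t * d) (det-equal-columns A′ k≢c A′-kc) ⟩
    det A + t * 0ℤ         ≡⟨ cong (_+_ (det A)) (ℤP.*-zeroʳ t) ⟩
    det A + 0ℤ             ≡⟨ ℤP.+-identityʳ (det A) ⟩
    det A                  ∎
    where
    open ≡-Reasoning
    A′ : Mat _
    A′ = setColumn A k (λ i → A i c)
    B-k′ : ∀ i → B i k ≡ A i k + t * A′ i k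
    B-k′ i = trans (B-k i) (cong (λ a → A i k + t * a) (sym (setColumn-same A k (λ i → A i c) i)))
    A′-kc : ∀ i → A′ i k ≡ A′ i c
    A′-kc i = trans (setColumn-same A k (λ i → A i c) i) (sym (setColumn-other A k (λ i → A i c) i c (k≢c ∘ sym)))

  _ᵀ : Mat n → Mat n
  (A ᵀ) i j = A j i

  det-expand-first-column : (A : Mat (suc n)) →
    det A ≡ sumℤ (λ i → sign i * A i zero * det (λ k l → A (punchIn i k) (suc l)))
  det-expand-first-column {zero}  A = refl
  det-expand-first-column {suc n} A = cong (_+_ (sign {suc (suc n)} zero * A zero zero * det (minor A zero))) (begin
    sumℤ (λ j → a j * det (minor A (suc j)))
      ≡⟨ sumℤ-cong (λ j → cong (a j *_) (det-expand-first-column (minor A (suc j)))) ⟩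
    sumℤ (λ j → a j * sumℤ (λ i → sign i * A (suc i) zero * X i j))
      ≡⟨ sumℤ-cong (λ j → sym (sumℤ-*ˡ (a j) (λ i → sign i * A (suc i) zero * X i j))) ⟩
    sumℤ (λ j → sumℤ (λ i → a j * (sign i * A (suc i) zero * X i j)))
      ≡⟨ sumℤ-comm (λ j i → a j * (sign i * A (suc i) zero * X i j)) ⟩
    sumℤ (λ i → sumℤ (λ j → a j * (sign i * A (suc i) zero * X i j)))
      ≡⟨ sumℤ-cong (λ i → sumℤ-cong (λ j → exchange (sign j) (A zero (suc j)) (sign i) (A (suc i) zero) (X i j))) ⟩
    sumℤ (λ i → sumℤ (λ j → b i * (sign j * A zero (suc j) * X i j)))
      ≡⟨ sumℤ-cong (λ i → sumℤ-*ˡ (b i) (λ j → sign j * A zero (suc j) * X i j)) ⟩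
    sumℤ (λ i → b i * det (λ k l → A (punchIn (suc i) k) (suc l))) ∎)
    where
    open ≡-Reasoning
    a b : Fin (suc n) → ℤ
    a j = sign (suc j) * A zero (suc j)
    b i = sign (suc i) * A (suc i) zero
    X : Fin (suc n) → Fin (suc n) → ℤ
    X i j = det (λ k l → A (suc (punchIn i k)) (suc (punchIn j l)))
    exchange : ∀ sj a si b x → (-1ℤ * sj) * a * (si * b * x) ≡ (-1ℤ * si) * b * (sj * a * x)
    exchange = solve-∀

  det-ᵀ : (A : Mat n) → det (A ᵀ) ≡ det A
  det-ᵀ {zero}  A = refl
  det-ᵀ {suc n} A = begin
    sumℤ (λ j → sign j * A j zero * det (minor (A ᵀ) j))
      ≡⟨ sumℤ-cong (λ j → cong (sign j * A j zero *_) (det-ᵀ (λ k l → A (punchIn j k) (suc l)))) ⟩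
    sumℤ (λ j → sign j * A j zero * det (λ k l → A (punchIn j k) (suc l)))
      ≡⟨ det-expand-first-column A ⟨
    det A ∎
    where
    open ≡-Reasoning

  swapRows : Mat n → Fin n → Fin n → Mat n
  swapRows A c d i l = A (PC.transpose c d i) l

  det-swapRows : (A : Mat n) {c d : Fin n} → c ≢ d → det (swapRows A c d) ≡ - det A
  det-swapRows A {c} {d} c≢d = begin
    det (swapRows A c d)              ≡⟨ det-ᵀ (swapRows A c d) ⟨
    det (swapColumns (A ᵀ) c d)       ≡⟨ det-swapColumns (A ᵀ) c≢d ⟩
    - det (A ᵀ)                       ≡⟨ cong -_ (det-ᵀ A) ⟩
    - det A                           ∎
    where
    open ≡-Reasoning

  conjugate : Mat n → Fin n → Fin n → Mat n
  conjugate A c d i l = A (PC.transpose c d i) (PC.transpose c d l)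

  det-conjugate : (A : Mat n) (c d : Fin n) → det (conjugate A c d) ≡ det A
  det-conjugate A c d with c ≟ d
  ... | yes refl = det-cong λ i l → cong₂ A (transpose-self c i) (transpose-self c l)
    where
    transpose-self : ∀ c k → PC.transpose c c k ≡ k
    transpose-self c = fin-cases₂ c c (transpose-matchˡ c c) (transpose-matchˡ c c) (λ k k≢c _ → transpose-other k≢c k≢c)
  ... | no c≢d = begin
    det (swapRows (swapColumns A c d) c d)  ≡⟨ det-swapRows (swapColumns A c d) c≢d ⟩
    - det (swapColumns A c d)               ≡⟨ cong -_ (det-swapColumns A c≢d) ⟩
    - - det A                               ≡⟨ ℤP.neg-involutive (det A) ⟩
    det A                                   ∎
    where
    open ≡-Reasoning

  det-mod : {A B : Mat n} → (∀ i j → A i j ≡ B i j ⟨mod m ⟩) → det A ≡ det B ⟨mod m ⟩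
  det-mod {zero}  _   = mod-refl
  det-mod {suc n} {A = A} {B} A≡B =
    mod-sumℤ {f = λ j → sign j * A zero j * det (minor A j)} {g = λ j → sign j * B zero j * det (minor B j)} λ j →
      mod-* (mod-* (mod-refl {a = sign j}) (A≡B zero j)) (det-mod λ i k → A≡B (suc i) (punchIn j k))

  det-zeroColumn : (A : Mat n) (c : Fin n) → (∀ i → A i c ≡ 0ℤ) → det A ≡ 0ℤ
  det-zeroColumn {suc n} A c A-c≡0 = sumℤ-zero term≡0
    where
    term≡0 : ∀ l → sign l * A zero l * det (minor A l) ≡ 0ℤ
    term≡0 l with l ≟ c
    ... | yes refl = trans (cong (λ a → sign l * a * det (minor A l)) (A-c≡0 zero))
                           (trans (cong (_* det (minor A l)) (ℤP.*-zeroʳ (sign l))) (ℤP.*-zeroˡ (det (minor A l))))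
    ... | no l≢c = trans (cong (sign l * A zero l *_)
                           (det-zeroColumn (minor A l) (punchOut l≢c) λ i → trans (minor-punchOut A l≢c i) (A-c≡0 (suc i))))
                         (ℤP.*-zeroʳ (sign l * A zero l))

  det-column≡0 : (A : Mat n) (c : Fin n) → (∀ i → A i c ≡ 0ℤ ⟨mod m ⟩) → det A ≡ 0ℤ ⟨mod m ⟩
  det-column≡0 A c A-c≡0 = mod-trans (det-mod A≡A′) (mod-reflexive (det-zeroColumn A′ c (setColumn-same A c (λ _ → 0ℤ))))
    where
    A′ : Mat _
    A′ = setColumn A c (λ _ → 0ℤ)
    A≡A′ : ∀ i l → A i l ≡ A′ i l ⟨mod _ ⟩
    A≡A′ i l with l ≟ c
    ... | yes refl = mod-trans (A-c≡0 i) (mod-reflexive (sym (setColumn-same A c (λ _ → 0ℤ) i)))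
    ... | no l≢c   = mod-reflexive (sym (setColumn-other A c (λ _ → 0ℤ) i l l≢c))

  zero-factor : ∀ s d → s * 0ℤ * d ≡ 0ℤ
  zero-factor s d = cong (_* d) (ℤP.*-zeroʳ s)

  det-firstRow-zero : (A : Mat (suc n)) → (∀ j → A zero (suc j) ≡ 0ℤ) → det A ≡ A zero zero * det (minor A zero)
  det-firstRow-zero A row≡0 = begin
    1ℤ * A zero zero * det (minor A zero) + sumℤ (λ j → sign (suc j) * A zero (suc j) * det (minor A (suc j)))
      ≡⟨ cong₂ _+_ (cong (_* det (minor A zero)) (ℤP.*-identityˡ (A zero zero)))
                   (sumℤ-zero λ j → trans (cong (λ a → sign (suc j) * a * det (minor A (suc j))) (row≡0 j))
                                          (zero-factor (sign (suc j)) (det (minor A (suc j))))) ⟩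
    A zero zero * det (minor A zero) + 0ℤ
      ≡⟨ ℤP.+-identityʳ _ ⟩
    A zero zero * det (minor A zero) ∎
    where
    open ≡-Reasoning

  det-block : (A : Mat (suc (suc n))) → (∀ j → A 0F (suc (suc j)) ≡ 0ℤ) → (∀ j → A 1F (suc (suc j)) ≡ 0ℤ) →
    det A ≡ (A 0F 0F * A 1F 1F - A 0F 1F * A 1F 0F) * det (λ i k → A (suc (suc i)) (suc (suc k)))
  det-block A row₀≡0 row₁≡0 = begin
    det A
      ≡⟨ cong₂ (λ d₀ d₁ → 1ℤ * A 0F 0F * d₀ + (-1ℤ * A 0F 1F * d₁ + rest))
               (det-firstRow-zero (minor A 0F) row₁≡0) (det-firstRow-zero (minor A 1F) row₁≡0) ⟩
    1ℤ * A 0F 0F * (A 1F 1F * D) + (-1ℤ * A 0F 1F * (A 1F 0F * D) + rest)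
      ≡⟨ cong (λ r → 1ℤ * A 0F 0F * (A 1F 1F * D) + (-1ℤ * A 0F 1F * (A 1F 0F * D) + r))
              (sumℤ-zero λ j → trans (cong (λ a → sign (suc (suc j)) * a * det (minor A (suc (suc j)))) (row₀≡0 j))
                                     (zero-factor (sign (suc (suc j))) (det (minor A (suc (suc j)))))) ⟩
    1ℤ * A 0F 0F * (A 1F 1F * D) + (-1ℤ * A 0F 1F * (A 1F 0F * D) + 0ℤ)
      ≡⟨ expand-2×2 (A 0F 0F) (A 0F 1F) (A 1F 0F) (A 1F 1F) D ⟩
    (A 0F 0F * A 1F 1F - A 0F 1F * A 1F 0F) * D ∎
    where
    open ≡-Reasoning
    D : ℤ
    D = det (λ i k → A (suc (suc i)) (suc (suc k)))
    rest : ℤ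
    rest = sumℤ (λ j → sign (suc (suc j)) * A 0F (suc (suc j)) * det (minor A (suc (suc j))))
    expand-2×2 : ∀ a b c d x → 1ℤ * a * (d * x) + (-1ℤ * b * (c * x) + 0ℤ) ≡ (a * d - b * c) * x
    expand-2×2 = solve-∀

  det-firstRowColumn≡0 : ∀ {a b} (A : Mat (suc n)) → (∀ j → A zero (suc j) ≡ 0ℤ ⟨mod a ⟩) →
    (∀ i → A (suc i) zero ≡ 0ℤ ⟨mod b ⟩) → det A ≡ A zero zero * det (minor A zero) ⟨mod a ℕ.* b ⟩
  det-firstRowColumn≡0 {zero} A _ _ = mod-reflexive (one-by-one (A zero zero))
    where
    one-by-one : ∀ a → 1ℤ * a * 1ℤ + 0ℤ ≡ a * 1ℤ
    one-by-one = solve-∀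
  det-firstRowColumn≡0 {suc n} {a} {b} A row≡0 column≡0 = begin
    1ℤ * A zero zero * det (minor A zero) + sumℤ term
      ≈⟨ mod-+ (mod-refl {a = 1ℤ * A zero zero * det (minor A zero)}) (mod-sumℤ {f = term} {g = λ _ → 0ℤ} term≡0) ⟩
    1ℤ * A zero zero * det (minor A zero) + sumℤ {suc n} (λ _ → 0ℤ)
      ≡⟨ cong₂ _+_ (cong (_* det (minor A zero)) (ℤP.*-identityˡ (A zero zero)))
                   (sumℤ-zero {f = λ (_ : Fin (suc n)) → 0ℤ} λ _ → refl) ⟩
    A zero zero * det (minor A zero) + 0ℤ
      ≡⟨ ℤP.+-identityʳ _ ⟩
    A zero zero * det (minor A zero) ∎
    where
    open ≡-mod-Reasoning (a ℕ.* b)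
    term : Fin (suc n) → ℤ
    term j = sign (suc j) * A zero (suc j) * det (minor A (suc j))
    term≡0 : ∀ j → term j ≡ 0ℤ ⟨mod a ℕ.* b ⟩
    term≡0 j = mod-*-zero
      (mod-trans (mod-* (mod-refl {a = sign (suc j)}) (row≡0 j)) (mod-reflexive (ℤP.*-zeroʳ (sign (suc j)))))
      (det-column≡0 (minor A (suc j)) zero column≡0)

  <ᵇ-irrefl : ∀ a → (a <ᵇ a) ≡ false
  <ᵇ-irrefl zero    = refl
  <ᵇ-irrefl (suc a) = <ᵇ-irrefl a

  <ᵇ-suc-self : ∀ a → (a <ᵇ suc a) ≡ true
  <ᵇ-suc-self zero    = refl
  <ᵇ-suc-self (suc a) = <ᵇ-suc-self a

  <ᵇ-suc-≢ : ∀ {a b} → a ≢ b → (a <ᵇ suc b) ≡ (a <ᵇ b)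
  <ᵇ-suc-≢ {zero}  {zero}  a≢b = ⊥-elim (a≢b refl)
  <ᵇ-suc-≢ {zero}  {suc b} _   = refl
  <ᵇ-suc-≢ {suc a} {zero}  _   = refl
  <ᵇ-suc-≢ {suc a} {suc b} a≢b = <ᵇ-suc-≢ (a≢b ∘ cong suc)

  <ᵇ-toℕ : (l : Fin n) → (toℕ l <ᵇ n) ≡ true
  <ᵇ-toℕ zero    = refl
  <ᵇ-toℕ (suc l) = <ᵇ-toℕ l

  addToColumns : Mat n → Fin n → (Fin n → ℤ) → Mat n
  addToColumns A c t i l = A i l + t l * A i c

  -- Induction on the number m of columns already modified, each step being one column operation.
  det-addToColumns : (A : Mat n) (c : Fin n) (t : Fin n → ℤ) → t c ≡ 0ℤ → det (addToColumns A c t) ≡ det A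
  det-addToColumns {n} A c t t-c≡0 = trans (det-cong λ i l → cong (λ s → A i l + s * A i c) (sym (take-all l)))
                                            (take-invariant n)
    where
    take : ℕ → Fin n → ℤ
    take m l = if toℕ l <ᵇ m then t l else 0ℤ
    take-all : ∀ l → take n l ≡ t l
    take-all l rewrite <ᵇ-toℕ l = refl
    take-c : ∀ m → take m c ≡ 0ℤ
    take-c m with toℕ c <ᵇ m
    ... | true  = t-c≡0
    ... | false = refl
    take-other : ∀ m l → toℕ l ≢ m → take (suc m) l ≡ take m l
    take-other m l l≢m rewrite <ᵇ-suc-≢ l≢m = refl
    at : ℕ → Mat n
    at m = addToColumns A c (take m)
    step : (k : Fin n) → det (at (suc (toℕ k))) ≡ det (at (toℕ k))
    step k with k ≟ c
    ... | yes refl = det-cong λ i → fin-cases₂ k k (same i) (same i) λ l l≢k _ →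
            cong (λ s → A i l + s * A i k) (take-other (toℕ k) l (l≢k ∘ FinP.toℕ-injective))
      where
      same : ∀ i → at (suc (toℕ k)) i k ≡ at (toℕ k) i k
      same i = cong (λ s → A i k + s * A i k) (trans (take-c (suc (toℕ k))) (sym (take-c (toℕ k))))
    ... | no k≢c = det-addColumnMultiple (t k) k≢c
            (λ i l l≢k → cong (λ s → A i l + s * A i c) (take-other (toℕ k) l (l≢k ∘ FinP.toℕ-injective)))
            λ i → begin
              A i k + take (suc (toℕ k)) k * A i c
                ≡⟨ cong (λ b → A i k + (if b then t k else 0ℤ) * A i c) (<ᵇ-suc-self (toℕ k)) ⟩
              A i k + t k * A i c
                ≡⟨ cong₂ (λ a b → a + t k * b) (ℤP.+-identityʳ (A i k)) (ℤP.+-identityʳ (A i c)) ⟨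
              (A i k + 0ℤ) + t k * (A i c + 0ℤ)
                ≡⟨ cong₂ (λ b s → (A i k + (if b then t k else 0ℤ) * A i c) + t k * (A i c + s * A i c))
                         (<ᵇ-irrefl (toℕ k)) (take-c (toℕ k)) ⟨
              at (toℕ k) i k + t k * at (toℕ k) i c ∎
      where
      open ≡-Reasoning
    take-invariant : ∀ m → det (at m) ≡ det A
    take-invariant zero    = det-cong λ i l → ℤP.+-identityʳ (A i l)
    take-invariant (suc m) with m ℕ.<? n
    ... | yes m<n = trans (subst (λ x → det (at (suc x)) ≡ det (at x)) (FinP.toℕ-fromℕ< m<n) (step (Fin.fromℕ< m<n)))
                          (take-invariant m)
    ... | no m≮n  = trans (det-cong λ i l → cong (λ s → A i l + s * A i c)
                            (take-other m l λ l≡m → m≮n (subst (ℕ._< n) l≡m (FinP.toℕ<n l))))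
                          (take-invariant m)

  pivotDet : Mat (suc (suc n)) → ℤ
  pivotDet A = A 0F 0F * A 1F 1F - A 0F 1F * A 1F 0F

  -- Column k + 2 receives -δ · adj(P) applied to its top two entries, where P is the top-left
  -- 2×2 block and δ = det P; since P · adj(P) = δ, this scales those entries by 1 - δ².
  schurShift₀ schurShift₁ : Mat (suc (suc n)) → Fin (suc (suc n)) → ℤ
  schurShift₀ A 0F            = 0ℤ
  schurShift₀ A 1F            = 0ℤ
  schurShift₀ A (suc (suc k)) = - pivotDet A * (A 1F 1F * A 0F (suc (suc k)) - A 0F 1F * A 1F (suc (suc k)))
  schurShift₁ A 0F            = 0ℤ
  schurShift₁ A 1F            = 0ℤ
  schurShift₁ A (suc (suc k)) = - pivotDet A * (A 0F 0F * A 1F (suc (suc k)) - A 1F 0F * A 0F (suc (suc k)))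

  cleared : Mat (suc (suc n)) → Mat (suc (suc n))
  cleared A i l = A i l + schurShift₀ A l * A i 0F + schurShift₁ A l * A i 1F

  schur : Mat (suc (suc n)) → Mat n
  schur A i k = cleared A (suc (suc i)) (suc (suc k))

  det-cleared : (A : Mat (suc (suc n))) → det (cleared A) ≡ det A
  det-cleared A = begin
    det (cleared A)    ≡⟨ det-cong (λ i l → cong (λ x → A i l + schurShift₀ A l * A i 0F + schurShift₁ A l * x)
                                               (ℤP.+-identityʳ (A i 1F))) ⟨
    det (addToColumns (addToColumns A 0F (schurShift₀ A)) 1F (schurShift₁ A))
                       ≡⟨ det-addToColumns (addToColumns A 0F (schurShift₀ A)) 1F (schurShift₁ A) refl ⟩
    det (addToColumns A 0F (schurShift₀ A))
                       ≡⟨ det-addToColumns A 0F (schurShift₀ A) refl ⟩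
    det A              ∎
    where
    open ≡-Reasoning

  det-schur : (A : Mat (suc (suc n))) → pivotDet A * pivotDet A ≡ 1ℤ ⟨mod m ⟩ →
    det A ≡ pivotDet A * det (schur A) ⟨mod m ⟩
  det-schur {n} {m} A δ²≡1 = begin
    det A                          ≡⟨ det-cleared A ⟨
    det (cleared A)                ≈⟨ det-mod cleared≡T ⟩
    det T                          ≡⟨ det-block T (λ _ → refl) (λ _ → refl) ⟩
    (T 0F 0F * T 1F 1F - T 0F 1F * T 1F 0F) * det (schur A)
                                   ≡⟨ cong (_* det (schur A)) (pivot-block (A 0F 0F) (A 0F 1F) (A 1F 0F) (A 1F 1F)) ⟩
    pivotDet A * det (schur A)     ∎
    where
    open ≡-mod-Reasoning m
    δ : ℤ
    δ = pivotDet A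
    T : Mat (suc (suc n))
    T 0F (suc (suc k)) = 0ℤ
    T 1F (suc (suc k)) = 0ℤ
    T i  l             = cleared A i l
    row₀ : ∀ a b c d p r → p + (- (a * d - b * c) * (d * p - b * r)) * a + (- (a * d - b * c) * (a * r - c * p)) * b
                          ≡ (1ℤ - (a * d - b * c) * (a * d - b * c)) * p
    row₀ = solve-∀
    row₁ : ∀ a b c d p r → r + (- (a * d - b * c) * (d * p - b * r)) * c + (- (a * d - b * c) * (a * r - c * p)) * d
                          ≡ (1ℤ - (a * d - b * c) * (a * d - b * c)) * r
    row₁ = solve-∀
    pivot-block : ∀ a b c d → (a + 0ℤ * a + 0ℤ * b) * (d + 0ℤ * c + 0ℤ * d)
                              - (b + 0ℤ * a + 0ℤ * b) * (c + 0ℤ * c + 0ℤ * d)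
                            ≡ a * d - b * c
    pivot-block = solve-∀
    1-δ²≡0 : 1ℤ - δ * δ ≡ 0ℤ ⟨mod m ⟩
    1-δ²≡0 = mod-trans (mod-+ (mod-refl {a = 1ℤ}) (mod-neg δ²≡1)) (mod-reflexive (ℤP.+-inverseʳ 1ℤ))
    scaled≡0 : ∀ x → (1ℤ - δ * δ) * x ≡ 0ℤ ⟨mod m ⟩
    scaled≡0 x = mod-trans (mod-* 1-δ²≡0 (mod-refl {a = x})) (mod-reflexive (ℤP.*-zeroˡ x))
    cleared≡T : ∀ i l → cleared A i l ≡ T i l ⟨mod m ⟩
    cleared≡T 0F (suc (suc k)) =
      mod-trans (mod-reflexive (row₀ (A 0F 0F) (A 0F 1F) (A 1F 0F) (A 1F 1F) (A 0F (suc (suc k))) (A 1F (suc (suc k)))))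
                (scaled≡0 (A 0F (suc (suc k))))
    cleared≡T 1F (suc (suc k)) =
      mod-trans (mod-reflexive (row₁ (A 0F 0F) (A 0F 1F) (A 1F 0F) (A 1F 1F) (A 0F (suc (suc k))) (A 1F (suc (suc k)))))
                (scaled≡0 (A 1F (suc (suc k))))
    cleared≡T 0F 0F = mod-refl
    cleared≡T 0F 1F = mod-refl
    cleared≡T 1F 0F = mod-refl
    cleared≡T 1F 1F = mod-refl
    cleared≡T (suc (suc i)) l = mod-refl

module Counting where

  open import Defs
  open Arithmetic
  open import Data.Bool using (Bool; true; false; not; _∧_; _xor_; if_then_else_)
  open import Data.Bool.ListAction using (any)
  import Data.Bool.Properties as BoolP
  open import Data.Bool.Solver using (module xor-∧-Solver)
  open import Data.Fin using (Fin; zero; suc)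
  open import Data.List as List using (List; filterᵇ; length)
  import Data.List.Properties as ListP
  open import Data.Nat as ℕ using (ℕ; zero; suc; _+_; _*_; _^_)
  open import Data.Nat.ListAction using (sum)
  open import Data.Nat.ListAction.Properties using (sum-++)
  import Data.Nat.Properties as ℕP
  open import Algebra.Properties.CommutativeSemigroup ℕP.+-commutativeSemigroup using (interchange)
  open import Algebra.Properties.CommutativeSemigroup ℕP.*-commutativeSemigroup using (x∙yz≈y∙xz)
  open import Data.Empty using (⊥-elim)
  open import Data.Product using (∃; _,_; _×_)
  open import Data.Sum using (inj₁; inj₂)
  open import Data.Vec.Functional using (_∷_; tail)
  open import Function using (_∘_)
  open import Function.Bundles using (_⇔_; mk⇔)
  open import Relation.Binary.PropositionalEquality

  private
    variable
      n : ℕ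
      A : Set

  𝟙 : Bool → ℕ
  𝟙 b = if b then 1 else 0

  count : (Vec₂ n → Bool) → ℕ
  count {n} P = length (filterᵇ P (allVecs n))

  ∑ᵥ : (Vec₂ n → ℕ) → ℕ
  ∑ᵥ {n} f = sum (List.map f (allVecs n))

  length-filterᵇ : (P : A → Bool) (xs : List A) → length (filterᵇ P xs) ≡ sum (List.map (𝟙 ∘ P) xs)
  length-filterᵇ P List.[] = refl
  length-filterᵇ P (x List.∷ xs) with P x
  ... | true  = cong suc (length-filterᵇ P xs)
  ... | false = length-filterᵇ P xs

  count≡∑ᵥ : (P : Vec₂ n → Bool) → count P ≡ ∑ᵥ (𝟙 ∘ P)
  count≡∑ᵥ {n} P = length-filterᵇ P (allVecs n)

  ∑ᵥ-cons : (f : Vec₂ (suc n) → ℕ) → ∑ᵥ f ≡ ∑ᵥ (λ x → f (false ∷ x)) + ∑ᵥ (λ x → f (true ∷ x))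
  ∑ᵥ-cons {n} f = begin
    sum (List.map f (List.map (false ∷_) vs List.++ List.map (true ∷_) vs))
      ≡⟨ cong sum (ListP.map-++ f (List.map (false ∷_) vs) (List.map (true ∷_) vs)) ⟩
    sum (List.map f (List.map (false ∷_) vs) List.++ List.map f (List.map (true ∷_) vs))
      ≡⟨ sum-++ (List.map f (List.map (false ∷_) vs)) (List.map f (List.map (true ∷_) vs)) ⟩
    sum (List.map f (List.map (false ∷_) vs)) + sum (List.map f (List.map (true ∷_) vs))
      ≡⟨ cong₂ (λ xs ys → sum xs + sum ys) (ListP.map-∘ vs) (ListP.map-∘ vs) ⟨
    ∑ᵥ (λ x → f (false ∷ x)) + ∑ᵥ (λ x → f (true ∷ x)) ∎
    where
    open ≡-Reasoning
    vs : List (Vec₂ n)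
    vs = allVecs n

  count-cons : (P : Vec₂ (suc n) → Bool) → count P ≡ count (λ x → P (false ∷ x)) + count (λ x → P (true ∷ x))
  count-cons P = begin
    count P
      ≡⟨ count≡∑ᵥ P ⟩
    ∑ᵥ (𝟙 ∘ P)
      ≡⟨ ∑ᵥ-cons (𝟙 ∘ P) ⟩
    ∑ᵥ (λ x → 𝟙 (P (false ∷ x))) + ∑ᵥ (λ x → 𝟙 (P (true ∷ x)))
      ≡⟨ cong₂ _+_ (count≡∑ᵥ (λ x → P (false ∷ x))) (count≡∑ᵥ (λ x → P (true ∷ x))) ⟨
    count (λ x → P (false ∷ x)) + count (λ x → P (true ∷ x)) ∎
    where
    open ≡-Reasoning

  ∑ᵥ-cong : {f g : Vec₂ n → ℕ} → (∀ v → f v ≡ g v) → ∑ᵥ f ≡ ∑ᵥ g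
  ∑ᵥ-cong {n} f≗g = cong sum (ListP.map-cong f≗g (allVecs n))

  count-cong : {P Q : Vec₂ n → Bool} → (∀ v → P v ≡ Q v) → count P ≡ count Q
  count-cong {P = P} {Q} P≗Q = trans (count≡∑ᵥ P) (trans (∑ᵥ-cong (cong 𝟙 ∘ P≗Q)) (sym (count≡∑ᵥ Q)))

  ∑ᵥ-distrib-+ : (f g : Vec₂ n → ℕ) → ∑ᵥ (λ v → f v + g v) ≡ ∑ᵥ f + ∑ᵥ g
  ∑ᵥ-distrib-+ {n} f g = go (allVecs n)
    where
    go : ∀ xs → sum (List.map (λ v → f v + g v) xs) ≡ sum (List.map f xs) + sum (List.map g xs)
    go List.[]        = refl
    go (x List.∷ xs) = trans (cong (f x + g x +_) (go xs)) (interchange (f x) (g x) _ _)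

  ∑ᵥ-*ʳ : (f : Vec₂ n → ℕ) (c : ℕ) → ∑ᵥ (λ v → f v * c) ≡ ∑ᵥ f * c
  ∑ᵥ-*ʳ {n} f c = go (allVecs n)
    where
    go : ∀ xs → sum (List.map (λ v → f v * c) xs) ≡ sum (List.map f xs) * c
    go List.[]        = refl
    go (x List.∷ xs) = trans (cong (f x * c +_) (go xs)) (sym (ℕP.*-distribʳ-+ c (f x) _))

  ∑ᵥ-zero : ∑ᵥ {n} (λ _ → 0) ≡ 0
  ∑ᵥ-zero {n} = go (allVecs n)
    where
    go : ∀ ws → sum (List.map (λ _ → 0) ws) ≡ 0
    go List.[]        = refl
    go (w List.∷ ws) = go ws

  ∑ᵥ-comm : ∀ {m} (f : Vec₂ n → Vec₂ m → ℕ) →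
    ∑ᵥ (λ v → ∑ᵥ (f v)) ≡ ∑ᵥ (λ w → ∑ᵥ (λ v → f v w))
  ∑ᵥ-comm {n} {m} f = go (allVecs n)
    where
    go : ∀ xs → sum (List.map (λ v → ∑ᵥ (f v)) xs) ≡ ∑ᵥ (λ w → sum (List.map (λ v → f v w) xs))
    go List.[]        = sym (∑ᵥ-zero {m})
    go (x List.∷ xs) = trans (cong (∑ᵥ (f x) +_) (go xs)) (sym (∑ᵥ-distrib-+ (f x) _))

  allᵇ⇒ : {f : Fin n → Bool} → allᵇ f ≡ true → ∀ i → f i ≡ true
  allᵇ⇒ {suc n} {f} all≡true i with f zero in f0≡true
  allᵇ⇒ {suc n} {f} all≡true zero    | true = f0≡true
  allᵇ⇒ {suc n} {f} all≡true (suc i) | true = allᵇ⇒ all≡true i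

  ⇒allᵇ : {f : Fin n → Bool} → (∀ i → f i ≡ true) → allᵇ f ≡ true
  ⇒allᵇ {zero}  _    = refl
  ⇒allᵇ {suc n} f≡true rewrite f≡true zero = ⇒allᵇ (f≡true ∘ suc)

  allᵇ-cong : {f g : Fin n → Bool} → (∀ i → f i ≡ g i) → allᵇ f ≡ allᵇ g
  allᵇ-cong {zero}  _   = refl
  allᵇ-cong {suc n} f≗g = cong₂ _∧_ (f≗g zero) (allᵇ-cong (f≗g ∘ suc))

  Bool-≡ : ∀ {b c} → (b ≡ true → c ≡ true) → (c ≡ true → b ≡ true) → b ≡ c
  Bool-≡ {false} {false} _ _ = refl
  Bool-≡ {false} {true}  _ c⇒b = c⇒b refl
  Bool-≡ {true}  {false} b⇒c _ = sym (b⇒c refl)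
  Bool-≡ {true}  {true}  _ _ = refl

  xnor⇒≡ : ∀ a b → not (a xor b) ≡ true → a ≡ b
  xnor⇒≡ false false _ = refl
  xnor⇒≡ true  true  _ = refl

  ≡⇒xnor : ∀ a b → a ≡ b → not (a xor b) ≡ true
  ≡⇒xnor false _ refl = refl
  ≡⇒xnor true  _ refl = refl

  eqᵇ⇒≗ : (v w : Vec₂ n) → eqᵇ v w ≡ true → v ≗ w
  eqᵇ⇒≗ v w v≡w i = xnor⇒≡ (v i) (w i) (allᵇ⇒ v≡w i)

  ≗⇒eqᵇ : {v w : Vec₂ n} → v ≗ w → eqᵇ v w ≡ true
  ≗⇒eqᵇ {v = v} {w} v≗w = ⇒allᵇ λ i → ≡⇒xnor (v i) (w i) (v≗w i)

  Respects≗ : (Vec₂ n → A) → Set _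
  Respects≗ f = ∀ {v w} → v ≗ w → f v ≡ f w

  cons-≗ : ∀ b {u v : Vec₂ n} → u ≗ v → (b ∷ u) ≗ (b ∷ v)
  cons-≗ b u≗v zero    = refl
  cons-≗ b u≗v (suc i) = u≗v i

  head∷tail-≗ : ∀ {b} (w : Vec₂ (suc n)) → w zero ≡ b → (b ∷ tail w) ≗ w
  head∷tail-≗ w w₀≡b zero    = sym w₀≡b
  head∷tail-≗ w w₀≡b (suc i) = refl

  ∑ᵥ-select : (f : Vec₂ n → ℕ) → Respects≗ f → ∀ w → ∑ᵥ (λ u → 𝟙 (eqᵇ u w) * f u) ≡ f w
  ∑ᵥ-select {zero}  f f-resp w = trans (ℕP.+-identityʳ _) (trans (ℕP.+-identityʳ _) (f-resp λ ()))
  ∑ᵥ-select {suc n} f f-resp w = trans (∑ᵥ-cons (λ u → 𝟙 (eqᵇ u w) * f u)) (by-head (w zero) refl)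
    where
    select : ∀ b → ∑ᵥ (λ u → 𝟙 (eqᵇ u (tail w)) * f (b ∷ u)) ≡ f (b ∷ tail w)
    select b = ∑ᵥ-select (f ∘ (b ∷_)) (λ u≗v → f-resp (cons-≗ b u≗v)) (tail w)
    by-head : ∀ b → w zero ≡ b →
      ∑ᵥ (λ u → 𝟙 (not (false xor b) ∧ eqᵇ u (tail w)) * f (false ∷ u)) +
      ∑ᵥ (λ u → 𝟙 (not (true xor b) ∧ eqᵇ u (tail w)) * f (true ∷ u)) ≡ f w
    by-head false w₀≡ = trans (cong₂ _+_ (select false) (∑ᵥ-zero {n}))
                              (trans (ℕP.+-identityʳ _) (f-resp (head∷tail-≗ w w₀≡)))
    by-head true  w₀≡ = trans (cong₂ _+_ (∑ᵥ-zero {n}) (select true)) (f-resp (head∷tail-≗ w w₀≡))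

  eqᵇ-sym : (v w : Vec₂ n) → eqᵇ v w ≡ eqᵇ w v
  eqᵇ-sym v w = allᵇ-cong λ i → cong not (BoolP.xor-comm (v i) (w i))

  -- Double counting: ∑ᵥ (f ∘ φ) = ∑ᵤ f u · #{v ∣ u ≗ φ v}, and every u has the single preimage φ u.
  ∑ᵥ-involution : (f : Vec₂ n → ℕ) → Respects≗ f → (φ : Vec₂ n → Vec₂ n) →
    (∀ {v w} → v ≗ w → φ v ≗ φ w) → (∀ v → φ (φ v) ≗ v) → ∑ᵥ (f ∘ φ) ≡ ∑ᵥ f
  ∑ᵥ-involution f f-resp φ φ-resp φφ≗id = begin
    ∑ᵥ (λ v → f (φ v))
      ≡⟨ ∑ᵥ-cong (λ v → ∑ᵥ-select f f-resp (φ v)) ⟨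
    ∑ᵥ (λ v → ∑ᵥ (λ u → 𝟙 (eqᵇ u (φ v)) * f u))
      ≡⟨ ∑ᵥ-comm (λ v u → 𝟙 (eqᵇ u (φ v)) * f u) ⟩
    ∑ᵥ (λ u → ∑ᵥ (λ v → 𝟙 (eqᵇ u (φ v)) * f u))
      ≡⟨ ∑ᵥ-cong (λ u → ∑ᵥ-*ʳ (λ v → 𝟙 (eqᵇ u (φ v))) (f u)) ⟩
    ∑ᵥ (λ u → ∑ᵥ (λ v → 𝟙 (eqᵇ u (φ v))) * f u)
      ≡⟨ ∑ᵥ-cong (λ u → cong (_* f u) (one-preimage u)) ⟩
    ∑ᵥ (λ u → 1 * f u)
      ≡⟨ ∑ᵥ-cong (λ u → ℕP.*-identityˡ (f u)) ⟩
    ∑ᵥ f ∎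
    where
    open ≡-Reasoning
    flip : ∀ u v → eqᵇ u (φ v) ≡ eqᵇ v (φ u)
    flip u v = Bool-≡ (λ u≡φv → ≗⇒eqᵇ (preimage v u u≡φv)) (λ v≡φu → ≗⇒eqᵇ (preimage u v v≡φu))
      where
      preimage : ∀ a b → eqᵇ b (φ a) ≡ true → a ≗ φ b
      preimage a b b≡φa i = trans (sym (φφ≗id a i)) (φ-resp (λ j → sym (eqᵇ⇒≗ b (φ a) b≡φa j)) i)
    one-preimage : ∀ u → ∑ᵥ (λ v → 𝟙 (eqᵇ u (φ v))) ≡ 1
    one-preimage u = begin
      ∑ᵥ (λ v → 𝟙 (eqᵇ u (φ v)))
        ≡⟨ ∑ᵥ-cong (λ v → trans (cong 𝟙 (flip u v)) (sym (ℕP.*-identityʳ _))) ⟩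
      ∑ᵥ (λ v → 𝟙 (eqᵇ v (φ u)) * 1)
        ≡⟨ ∑ᵥ-select (λ _ → 1) (λ _ → refl) (φ u) ⟩
      1 ∎

  count-involution : (P : Vec₂ n → Bool) → Respects≗ P → (φ : Vec₂ n → Vec₂ n) →
    (∀ {v w} → v ≗ w → φ v ≗ φ w) → (∀ v → φ (φ v) ≗ v) → count (P ∘ φ) ≡ count P
  count-involution P P-resp φ φ-resp φφ≗id = begin
    count (P ∘ φ)   ≡⟨ count≡∑ᵥ (P ∘ φ) ⟩
    ∑ᵥ (𝟙 ∘ P ∘ φ)  ≡⟨ ∑ᵥ-involution (𝟙 ∘ P) (cong 𝟙 ∘ P-resp) φ φ-resp φφ≗id ⟩
    ∑ᵥ (𝟙 ∘ P)      ≡⟨ count≡∑ᵥ P ⟨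
    count P         ∎
    where
    open ≡-Reasoning

  count-partition : (P f : Vec₂ n → Bool) → count (λ v → P v ∧ f v) + count (λ v → P v ∧ not (f v)) ≡ count P
  count-partition P f = begin
    count (λ v → P v ∧ f v) + count (λ v → P v ∧ not (f v))
      ≡⟨ cong₂ _+_ (count≡∑ᵥ (λ v → P v ∧ f v)) (count≡∑ᵥ (λ v → P v ∧ not (f v))) ⟩
    ∑ᵥ (λ v → 𝟙 (P v ∧ f v)) + ∑ᵥ (λ v → 𝟙 (P v ∧ not (f v)))
      ≡⟨ ∑ᵥ-distrib-+ (λ v → 𝟙 (P v ∧ f v)) (λ v → 𝟙 (P v ∧ not (f v))) ⟨
    ∑ᵥ (λ v → 𝟙 (P v ∧ f v) + 𝟙 (P v ∧ not (f v)))
      ≡⟨ ∑ᵥ-cong (λ v → split (P v) (f v)) ⟩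
    ∑ᵥ (𝟙 ∘ P)
      ≡⟨ count≡∑ᵥ P ⟨
    count P ∎
    where
    open ≡-Reasoning
    split : ∀ p b → 𝟙 (p ∧ b) + 𝟙 (p ∧ not b) ≡ 𝟙 p
    split false _     = refl
    split true  false = refl
    split true  true  = refl

  -- If P forces the head to be f of the tail (`not (b xor c)` tests b = c), P is counted on tails.
  count-graph : (f : Vec₂ n → Bool) (R : Bool → Vec₂ n → Bool) (P : Vec₂ (suc n) → Bool) →
    (∀ b x → P (b ∷ x) ≡ not (b xor f x) ∧ R b x) → count P ≡ count (λ x → R (f x) x)
  count-graph f R P P≡ = begin
    count P
      ≡⟨ count-cons P ⟩
    count (λ x → P (false ∷ x)) + count (λ x → P (true ∷ x))
      ≡⟨ cong₂ _+_ (count-cong (P≡ false)) (count-cong λ x → trans (P≡ true x)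
                                                        (cong (_∧ R true x) (BoolP.not-involutive (f x)))) ⟩
    count (λ x → not (f x) ∧ R false x) + count (λ x → f x ∧ R true x)
      ≡⟨ ℕP.+-comm (count (λ x → not (f x) ∧ R false x)) _ ⟩
    count (λ x → f x ∧ R true x) + count (λ x → not (f x) ∧ R false x)
      ≡⟨ cong₂ _+_ (count-cong λ x → forced (f x) (λ b → R b x)) (count-cong λ x → forced′ (f x) (λ b → R b x)) ⟨
    count (λ x → R (f x) x ∧ f x) + count (λ x → R (f x) x ∧ not (f x))
      ≡⟨ count-partition (λ x → R (f x) x) f ⟩
    count (λ x → R (f x) x) ∎
    where
    open ≡-Reasoning
    forced : ∀ b (r : Bool → Bool) → r b ∧ b ≡ b ∧ r true
    forced false r = BoolP.∧-zeroʳ (r false)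
    forced true  r = BoolP.∧-identityʳ (r true)
    forced′ : ∀ b (r : Bool → Bool) → r b ∧ not b ≡ not b ∧ r false
    forced′ false r = BoolP.∧-identityʳ (r false)
    forced′ true  r = BoolP.∧-zeroʳ (r true)

  ∑ᵥ-one : ∀ n → ∑ᵥ {n} (λ _ → 1) ≡ 2 ^ n
  ∑ᵥ-one zero    = refl
  ∑ᵥ-one (suc n) =
    trans (∑ᵥ-cons {n} (λ _ → 1)) (cong₂ _+_ (∑ᵥ-one n) (trans (∑ᵥ-one n) (sym (ℕP.+-identityʳ (2 ^ n)))))

  _⊕_ : Vec₂ n → Vec₂ n → Vec₂ n
  (v ⊕ w) i = v i xor w i

  xorSum-cong : {f g : Fin n → Bool} → (∀ j → f j ≡ g j) → xorSum f ≡ xorSum g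
  xorSum-cong {zero}  _   = refl
  xorSum-cong {suc n} f≗g = cong₂ _xor_ (f≗g zero) (xorSum-cong (f≗g ∘ suc))

  xorSum-false : {f : Fin n → Bool} → (∀ j → f j ≡ false) → xorSum f ≡ false
  xorSum-false {zero}  _      = refl
  xorSum-false {suc n} f≡false rewrite f≡false zero = xorSum-false (f≡false ∘ suc)

  xorSum-xor : (f g : Fin n → Bool) → xorSum (λ j → f j xor g j) ≡ xorSum f xor xorSum g
  xorSum-xor {zero}  f g = refl
  xorSum-xor {suc n} f g = trans (cong ((f zero xor g zero) xor_) (xorSum-xor (f ∘ suc) (g ∘ suc)))
                                 (regroup (f zero) (g zero) (xorSum (f ∘ suc)) (xorSum (g ∘ suc)))
    where
    open xor-∧-Solver
    regroup : ∀ a b c d → (a xor b) xor (c xor d) ≡ (a xor c) xor (b xor d)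
    regroup = solve 4 (λ a b c d → (a :+ b) :+ (c :+ d) := (a :+ c) :+ (b :+ d)) refl

  xorSum-∧ˡ : (b : Bool) (f : Fin n → Bool) → xorSum (λ j → b ∧ f j) ≡ b ∧ xorSum f
  xorSum-∧ˡ {zero}  b f = sym (BoolP.∧-zeroʳ b)
  xorSum-∧ˡ {suc n} b f = trans (cong ((b ∧ f zero) xor_) (xorSum-∧ˡ b (f ∘ suc)))
                                (sym (BoolP.∧-distribˡ-xor b (f zero) (xorSum (f ∘ suc))))

  applyBar-⊕ : (A : Mat n) (v w : Vec₂ n) → ∀ i → applyBar A (v ⊕ w) i ≡ applyBar A v i xor applyBar A w i
  applyBar-⊕ A v w i = trans (xorSum-cong λ j → BoolP.∧-distribˡ-xor (Abar A i j) (v j) (w j))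
                             (xorSum-xor (λ j → Abar A i j ∧ v j) (λ j → Abar A i j ∧ w j))

  applyBar-resp : (A : Mat n) {v w : Vec₂ n} → v ≗ w → ∀ i → applyBar A v i ≡ applyBar A w i
  applyBar-resp A v≗w i = xorSum-cong λ j → cong (Abar A i j ∧_) (v≗w j)

  InV0-resp : (A : Mat n) → Respects≗ (InV0 A)
  InV0-resp A v≗w = allᵇ-cong λ i → cong not (applyBar-resp A v≗w i)

  InIm : Mat n → Vec₂ n → Bool
  InIm {n} A w = any (λ v → eqᵇ (applyBar A v) w) (allVecs n)

  any⇒∃ : (g : A → Bool) (xs : List A) → any g xs ≡ true → ∃ λ x → g x ≡ true
  any⇒∃ g (x List.∷ xs) any≡true with g x in gx≡
  ... | true  = x , gx≡
  ... | false = any⇒∃ g xs any≡true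

  any≡false⇒∑≡0 : (g : A → Bool) (xs : List A) → any g xs ≡ false → sum (List.map (𝟙 ∘ g) xs) ≡ 0
  any≡false⇒∑≡0 g List.[]         _        = refl
  any≡false⇒∑≡0 g (x List.∷ xs) any≡false with g x
  ... | false = any≡false⇒∑≡0 g xs any≡false

  -- A nonempty fibre of Ā is a translate of V̄₀.
  fiber-size : (A : Mat n) (w : Vec₂ n) → ∑ᵥ (λ v → 𝟙 (eqᵇ (applyBar A v) w)) ≡ 𝟙 (InIm A w) * count (InV0 A)
  fiber-size {n} A w with InIm A w in inIm
  ... | false = any≡false⇒∑≡0 (λ v → eqᵇ (applyBar A v) w) (allVecs n) inIm
  ... | true with v₀ , Av₀≡w ← any⇒∃ (λ v → eqᵇ (applyBar A v) w) (allVecs n) inIm = begin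
    ∑ᵥ (λ v → 𝟙 (eqᵇ (applyBar A v) w))
      ≡⟨ ∑ᵥ-involution (λ v → 𝟙 (eqᵇ (applyBar A v) w)) fibre-resp
                       (_⊕ v₀) (λ v≗v′ i → cong (_xor v₀ i) (v≗v′ i)) (λ v i → xor-cancelʳ (v i) (v₀ i)) ⟨
    ∑ᵥ (λ v → 𝟙 (eqᵇ (applyBar A (v ⊕ v₀)) w))
      ≡⟨ ∑ᵥ-cong (λ v → cong 𝟙 (allᵇ-cong λ i → cong not (translate v i))) ⟩
    ∑ᵥ (𝟙 ∘ InV0 A)
      ≡⟨ count≡∑ᵥ (InV0 A) ⟨
    count (InV0 A)
      ≡⟨ ℕP.+-identityʳ _ ⟨
    1 * count (InV0 A) ∎
    where
    open ≡-Reasoning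
    fibre-resp : Respects≗ (λ v → 𝟙 (eqᵇ (applyBar A v) w))
    fibre-resp v≗v′ = cong 𝟙 (allᵇ-cong λ i → cong (λ b → not (b xor w i)) (applyBar-resp A v≗v′ i))
    xor-cancelʳ : ∀ a b → (a xor b) xor b ≡ a
    xor-cancelʳ a b = trans (BoolP.xor-assoc a b b) (trans (cong (a xor_) (BoolP.xor-same b)) (BoolP.xor-identityʳ a))
    translate : ∀ v i → applyBar A (v ⊕ v₀) i xor w i ≡ applyBar A v i
    translate v i = begin
      applyBar A (v ⊕ v₀) i xor w i
        ≡⟨ cong (_xor w i) (applyBar-⊕ A v v₀ i) ⟩
      (applyBar A v i xor applyBar A v₀ i) xor w i
        ≡⟨ cong (λ b → (applyBar A v i xor b) xor w i) (eqᵇ⇒≗ (applyBar A v₀) w Av₀≡w i) ⟩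
      (applyBar A v i xor w i) xor w i
        ≡⟨ xor-cancelʳ (applyBar A v i) (w i) ⟩
      applyBar A v i ∎

  rank-nullity : (A : Mat n) → length (ImBar A) * length (V0bar A) ≡ 2 ^ n
  rank-nullity {n} A = begin
    count (InIm A) * count (InV0 A)
      ≡⟨ cong (_* count (InV0 A)) (count≡∑ᵥ (InIm A)) ⟩
    ∑ᵥ (𝟙 ∘ InIm A) * count (InV0 A)
      ≡⟨ ∑ᵥ-*ʳ (𝟙 ∘ InIm A) (count (InV0 A)) ⟨
    ∑ᵥ (λ w → 𝟙 (InIm A w) * count (InV0 A))
      ≡⟨ ∑ᵥ-cong (fiber-size A) ⟨
    ∑ᵥ (λ w → ∑ᵥ (λ v → 𝟙 (eqᵇ (applyBar A v) w)))
      ≡⟨ ∑ᵥ-comm (λ w v → 𝟙 (eqᵇ (applyBar A v) w)) ⟩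
    ∑ᵥ (λ v → ∑ᵥ (λ w → 𝟙 (eqᵇ (applyBar A v) w)))
      ≡⟨ ∑ᵥ-cong (λ v → one-image v) ⟩
    ∑ᵥ {n} (λ _ → 1)
      ≡⟨ ∑ᵥ-one n ⟩
    2 ^ n ∎
    where
    open ≡-Reasoning
    one-image : ∀ v → ∑ᵥ (λ w → 𝟙 (eqᵇ (applyBar A v) w)) ≡ 1
    one-image v = trans (∑ᵥ-cong λ w → trans (cong 𝟙 (eqᵇ-sym (applyBar A v) w)) (sym (ℕP.*-identityʳ _)))
                        (∑ᵥ-select (λ _ → 1) (λ _ → refl) (applyBar A v))

  2^-split : ∀ d n x → x ℕ.* 2 ^ d ≡ 2 ^ n → ∃ λ r → x ≡ 2 ^ r × r ℕ.+ d ≡ n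
  2^-split zero    n       x x≡2^n = n , trans (sym (ℕP.*-identityʳ x)) x≡2^n , ℕP.+-identityʳ n
  2^-split (suc d) zero    x 2x2^d≡1 =
    ⊥-elim (ℕP.1+n≢n (ℕP.m*n≡1⇒m≡1 2 (x ℕ.* 2 ^ d) (trans (sym (x∙yz≈y∙xz x 2 (2 ^ d))) 2x2^d≡1)))
  2^-split (suc d) (suc n) x x2^d+1≡2^n+1
    with r , x≡2^r , r+d≡n ← 2^-split d n x (ℕP.*-cancelˡ-≡ (x ℕ.* 2 ^ d) (2 ^ n) 2
                                               (trans (sym (x∙yz≈y∙xz x 2 (2 ^ d))) x2^d+1≡2^n+1)) =
    r , x≡2^r , trans (ℕP.+-suc r d) (cong suc r+d≡n)

  2^-injective : ∀ {a b} → 2 ^ a ≡ 2 ^ b → a ≡ b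
  2^-injective {a} {b} 2^a≡2^b with r , 1≡2^r , r+a≡b ← 2^-split a b 1 (trans (ℕP.*-identityˡ (2 ^ a)) 2^a≡2^b)
    with ℕP.m^n≡1⇒n≡0∨m≡1 2 r (sym 1≡2^r)
  ... | inj₁ refl = r+a≡b
  ... | inj₂ ()

  rank⇔ : (A : Mat n) {d : ℕ} → HasDim (V0bar A) d → ∀ r → HasRank A r ⇔ r ℕ.+ d ≡ n
  rank⇔ {n} A {d} V0≡2^d r
    with r₀ , Im≡2^r₀ , r₀+d≡n ← 2^-split d n (length (ImBar A))
                                    (trans (cong (length (ImBar A) ℕ.*_) (sym V0≡2^d)) (rank-nullity A)) =
    mk⇔ (λ Im≡2^r → trans (cong (ℕ._+ d) (2^-injective (trans (sym Im≡2^r) Im≡2^r₀))) r₀+d≡n)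
        (λ r+d≡n → trans Im≡2^r₀ (cong (2 ^_) (ℕP.+-cancelʳ-≡ d r₀ r (trans r₀+d≡n (sym r+d≡n)))))

module QuadraticForm where

  open import Defs
  open Arithmetic
  open Determinant
  open Counting
  open import Data.Bool using (true; false; not; _∧_; _xor_)
  import Data.Bool.Properties as BoolP
  open import Data.Fin using (Fin; zero; suc)
  open import Data.Integer using (ℤ; +_; 0ℤ; 1ℤ; _+_; _*_; ∣_∣)
  import Data.Integer.Properties as ℤP
  open import Data.Integer.Tactic.RingSolver using (solve-∀)
  open import Data.Nat as ℕ using (ℕ; zero; suc)
  open import Data.Nat.DivMod using (m*n/n≡m)
  open import Data.Product using (∃; _,_)
  open import Data.Vec.Functional using (tail)
  open import Relation.Binary.PropositionalEquality

  private
    variable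
      n : ℕ

  bit-dot : (u : Fin n → ℤ) (x : Vec₂ n) → bit (sumℤ (λ j → u j * lift x j)) ≡ xorSum (λ j → bit (u j) ∧ x j)
  bit-dot u x = trans (bit-sumℤ (λ j → u j * lift x j))
                      (xorSum-cong λ j → trans (bit-* (u j) (lift x j)) (cong (bit (u j) ∧_) (bit-toℤ (x j))))

  firstRowDot : Mat (suc n) → (Fin (suc n) → ℤ) → ℤ
  firstRowDot A y = sumℤ (λ j → A zero (suc j) * y (suc j))

  form-cons : (A : Mat (suc n)) → Symmetric A → ∀ (y : Fin (suc n) → ℤ) →
    form A y y ≡ y zero * A zero zero * y zero + (y zero * firstRowDot A y + y zero * firstRowDot A y)
                 + form (minor A zero) (tail y) (tail y)
  form-cons {n} A sym-A y = begin
    (y₀ * A zero zero * y₀ + sumℤ (λ j → y₀ * A zero (suc j) * y (suc j)))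
      + sumℤ (λ i → y (suc i) * A (suc i) zero * y₀ + sumℤ (λ j → y (suc i) * A (suc i) (suc j) * y (suc j)))
      ≡⟨ cong₂ (λ p q → (y₀ * A zero zero * y₀ + p) + q) row-part
               (sumℤ-distrib-+ (λ i → y (suc i) * A (suc i) zero * y₀) _) ⟩
    (y₀ * A zero zero * y₀ + y₀ * s) + (sumℤ (λ i → y (suc i) * A (suc i) zero * y₀) + form C (tail y) (tail y))
      ≡⟨ cong (λ p → (y₀ * A zero zero * y₀ + y₀ * s) + (p + form C (tail y) (tail y))) column-part ⟩
    (y₀ * A zero zero * y₀ + y₀ * s) + (y₀ * s + form C (tail y) (tail y))
      ≡⟨ regroup (y₀ * A zero zero * y₀) (y₀ * s) (form C (tail y) (tail y)) ⟩
    y₀ * A zero zero * y₀ + (y₀ * s + y₀ * s) + form C (tail y) (tail y) ∎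
    where
    open ≡-Reasoning
    y₀ s : ℤ
    y₀ = y zero
    s = firstRowDot A y
    C : Mat n
    C = minor A zero
    regroup : ∀ a p f → (a + p) + (p + f) ≡ a + (p + p) + f
    regroup = solve-∀
    row-part : sumℤ (λ j → y₀ * A zero (suc j) * y (suc j)) ≡ y₀ * s
    row-part = trans (sumℤ-cong λ j → ℤP.*-assoc y₀ (A zero (suc j)) (y (suc j)))
                     (sumℤ-*ˡ y₀ (λ j → A zero (suc j) * y (suc j)))
    column-part : sumℤ (λ i → y (suc i) * A (suc i) zero * y₀) ≡ y₀ * s
    column-part = trans (sumℤ-cong λ i → trans (cong (λ a → y (suc i) * a * y₀) (sym-A (suc i) zero))
                                               (swap (y (suc i)) _ y₀))
                        row-part
      where
      swap : ∀ a b c → a * b * c ≡ c * b * a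
      swap = solve-∀

  form-cons-half : (A : Mat (suc n)) → Symmetric A → ∀ {α G} (y : Fin (suc n) → ℤ) → A zero zero ≡ α * + 2 →
    form (minor A zero) (tail y) (tail y) ≡ G * + 2 → form A y y ≡ (y zero * α * y zero + y zero * firstRowDot A y + G) * + 2
  form-cons-half A sym-A {α} {G} y a₀₀≡2α form-C≡2G = begin
    form A y y
      ≡⟨ form-cons A sym-A y ⟩
    y zero * A zero zero * y zero + (y zero * s + y zero * s) + form (minor A zero) (tail y) (tail y)
      ≡⟨ cong₂ (λ a f → y zero * a * y zero + (y zero * s + y zero * s) + f) a₀₀≡2α form-C≡2G ⟩
    y zero * (α * + 2) * y zero + (y zero * s + y zero * s) + G * + 2
      ≡⟨ halve (y zero) α s G ⟩
    (y zero * α * y zero + y zero * s + G) * + 2 ∎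
    where
    open ≡-Reasoning
    s : ℤ
    s = firstRowDot A y
    halve : ∀ y₀ α s G → y₀ * (α * + 2) * y₀ + (y₀ * s + y₀ * s) + G * + 2 ≡ (y₀ * α * y₀ + y₀ * s + G) * + 2
    halve = solve-∀

  minor-symmetric : (A : Mat (suc n)) → Symmetric A → Symmetric (minor A zero)
  minor-symmetric A sym-A i k = sym-A (suc i) (suc k)

  minor-evenDiagonal : (A : Mat (suc n)) → EvenDiagonal A → EvenDiagonal (minor A zero)
  minor-evenDiagonal A even-A i = even-A (suc i)

  form-even : (A : Mat n) → Symmetric A → EvenDiagonal A → ∀ y → ∃ λ G → form A y y ≡ G * + 2
  form-even {zero}  A _     _      y = 0ℤ , refl
  form-even {suc n} A sym-A even-A y
    with α , a₀₀≡2α ← even-quotient (A zero zero) (even-A zero)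
       | G , form-C≡2G ← form-even (minor A zero) (minor-symmetric A sym-A) (minor-evenDiagonal A even-A) (tail y) =
    y zero * α * y zero + y zero * firstRowDot A y + G , form-cons-half A sym-A {α = α} {G = G} y a₀₀≡2α form-C≡2G

  q-half : (A : Mat n) (v : Vec₂ n) {G : ℤ} → form A (lift v) (lift v) ≡ G * + 2 → q A v ≡ bit G
  q-half A v {G} form≡2G = cong (λ m → (m ℕ.% 2) ℕ.≡ᵇ 1) (begin
    ∣ form A (lift v) (lift v) ∣ ℕ./ 2   ≡⟨ cong (λ m → ∣ m ∣ ℕ./ 2) form≡2G ⟩
    ∣ G * + 2 ∣ ℕ./ 2                    ≡⟨ cong (ℕ._/ 2) (ℤP.abs-* G (+ 2)) ⟩
    ∣ G ∣ ℕ.* 2 ℕ./ 2                    ≡⟨ m*n/n≡m ∣ G ∣ 2 ⟩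
    ∣ G ∣                                ∎)
    where
    open ≡-Reasoning

  bit-toℤ-square : ∀ b a → bit (toℤ b * a * toℤ b) ≡ b ∧ bit a
  bit-toℤ-square false a = refl
  bit-toℤ-square true  a = cong bit (trans (ℤP.*-identityʳ (1ℤ * a)) (ℤP.*-identityˡ a))

  q-cons : (A : Mat (suc n)) → Symmetric A → EvenDiagonal A → ∀ {α} → A zero zero ≡ α * + 2 → ∀ v →
    q A v ≡ ((v zero ∧ bit α) xor (v zero ∧ bit (firstRowDot A (lift v)))) xor q (minor A zero) (tail v)
  q-cons A sym-A even-A {α} a₀₀≡2α v
    with G , form-C≡2G ← form-even (minor A zero) (minor-symmetric A sym-A) (minor-evenDiagonal A even-A) (lift (tail v)) =
    begin
    q A v
      ≡⟨ q-half A v {G = y₀ * α * y₀ + y₀ * s + G} (form-cons-half A sym-A {α = α} {G = G} (lift v) a₀₀≡2α form-C≡2G) ⟩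
    bit (y₀ * α * y₀ + y₀ * s + G)
      ≡⟨ trans (bit-+ (y₀ * α * y₀ + y₀ * s) G) (cong (_xor bit G) (bit-+ (y₀ * α * y₀) (y₀ * s))) ⟩
    (bit (y₀ * α * y₀) xor bit (y₀ * s)) xor bit G
      ≡⟨ cong₂ (λ a b → (a xor b) xor bit G) (bit-toℤ-square (v zero) α)
               (trans (bit-* y₀ s) (cong (_∧ bit s) (bit-toℤ (v zero)))) ⟩
    ((v zero ∧ bit α) xor (v zero ∧ bit s)) xor bit G
      ≡⟨ cong (((v zero ∧ bit α) xor (v zero ∧ bit s)) xor_) (q-half (minor A zero) (tail v) {G = G} form-C≡2G) ⟨
    ((v zero ∧ bit α) xor (v zero ∧ bit s)) xor q (minor A zero) (tail v) ∎
    where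
    open ≡-Reasoning
    y₀ s : ℤ
    y₀ = toℤ (v zero)
    s = firstRowDot A (lift v)

  zeroVec : Vec₂ n
  zeroVec _ = false

  InV0-zero : (A : Mat n) → InV0 A zeroVec ≡ true
  InV0-zero A = ⇒allᵇ λ i → cong not (xorSum-false λ j → BoolP.∧-zeroʳ (Abar A i j))

  q-zero : (A : Mat n) → q A zeroVec ≡ false
  q-zero {n} A = q-half A zeroVec {G = 0ℤ}
    (sumℤ-zero {f = λ i → sumℤ (λ j → lift zeroVec i * A i j * lift zeroVec j)} λ i →
     sumℤ-zero {f = λ j → lift {n} zeroVec i * A i j * lift zeroVec j} λ j → refl)

  lift-resp : {v w : Vec₂ n} → v ≗ w → lift v ≗ lift w
  lift-resp v≗w i = cong toℤ (v≗w i)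

  form-cong : (A : Mat n) {x x′ y y′ : Fin n → ℤ} → x ≗ x′ → y ≗ y′ → form A x y ≡ form A x′ y′
  form-cong A x≗x′ y≗y′ = sumℤ-cong λ i → sumℤ-cong λ j → cong₂ (λ a b → a * A i j * b) (x≗x′ i) (y≗y′ j)

  q-resp : (A : Mat n) → Respects≗ (q A)
  q-resp A v≗w = cong (λ F → ((∣ F ∣ ℕ./ 2) ℕ.% 2) ℕ.≡ᵇ 1) (form-cong A (lift-resp v≗w) (lift-resp v≗w))

  form-addOuter : (D : Mat n) (u g y : Fin n → ℤ) →
    form (λ i k → D i k + g k * u i) y y ≡ form D y y + sumℤ (λ i → y i * u i) * sumℤ (λ k → g k * y k)
  form-addOuter D u g y = begin
    sumℤ (λ i → sumℤ (λ k → y i * (D i k + g k * u i) * y k))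
      ≡⟨ sumℤ-cong (λ i → trans (sumℤ-cong λ k → split (y i) (D i k) (g k) (u i) (y k))
                                (trans (sumℤ-distrib-+ (λ k → y i * D i k * y k) (λ k → (y i * u i) * (g k * y k)))
                                       (cong (_+_ (sumℤ (λ k → y i * D i k * y k)))
                                             (sumℤ-*ˡ (y i * u i) (λ k → g k * y k))))) ⟩
    sumℤ (λ i → sumℤ (λ k → y i * D i k * y k) + y i * u i * sumℤ (λ k → g k * y k))
      ≡⟨ sumℤ-distrib-+ (λ i → sumℤ (λ k → y i * D i k * y k)) (λ i → y i * u i * sumℤ (λ k → g k * y k)) ⟩
    form D y y + sumℤ (λ i → y i * u i * sumℤ (λ k → g k * y k))
      ≡⟨ cong (_+_ (form D y y)) (sumℤ-*ʳ (λ i → y i * u i) (sumℤ (λ k → g k * y k))) ⟩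
    form D y y + sumℤ (λ i → y i * u i) * sumℤ (λ k → g k * y k) ∎
    where
    open ≡-Reasoning
    split : ∀ yi d gk ui yk → yi * (d + gk * ui) * yk ≡ yi * d * yk + (yi * ui) * (gk * yk)
    split = solve-∀

module Reduction where

  open import Defs
  open Arithmetic
  open Determinant
  open Counting
  open QuadraticForm
  open import Data.Bool using (Bool; true; false; not; _∧_; _xor_)
  import Data.Bool.Properties as BoolP
  open import Data.Bool.Solver using (module xor-∧-Solver)
  open import Data.Fin using (Fin; zero; suc)
  open import Data.Fin.Patterns using (0F; 1F)
  import Data.Fin.Permutation.Components as PC
  open import Data.Integer using (ℤ; +_; 0ℤ; 1ℤ; -1ℤ; _+_; _*_; -_; _-_; ∣_∣)
  open import Data.Integer.Divisibility.Signed using (∣⇒∣ᵤ; divides)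
  import Data.Integer.Properties as ℤP
  open import Data.Integer.Tactic.RingSolver using (solve-∀)
  open import Data.List using (length)
  open import Data.Nat as ℕ using (ℕ; zero; suc)
  import Data.Nat.Properties as ℕP
  open import Data.Product using (∃; _,_; _×_; proj₁; proj₂)
  open import Data.Vec.Functional using (_∷_; head; tail)
  open import Function using (_∘_)
  open import Relation.Binary.PropositionalEquality

  private
    variable
      n : ℕ

  QVanishes : Mat n → Set
  QVanishes A = ∀ v → InV0 A v ≡ true → q A v ≡ false

  QNonvanishing : Mat n → Set
  QNonvanishing A = ∃ λ v → InV0 A v ≡ true × q A v ≡ true

  module EvenFirstRow (A : Mat (suc n)) (sym-A : Symmetric A) (even-A : EvenDiagonal A)
                      (row-even : ∀ j → Abar A zero j ≡ false) {α : ℤ} (a₀₀≡2α : A zero zero ≡ α * + 2) where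

    C : Mat n
    C = minor A zero

    InV0-cons : ∀ v → InV0 A v ≡ InV0 C (tail v)
    InV0-cons v = cong₂ _∧_ (cong not row₀-vanishes) (allᵇ-cong λ i → cong not (row-suc i))
      where
      row₀-vanishes : applyBar A v zero ≡ false
      row₀-vanishes = xorSum-false λ j → cong (_∧ v j) (row-even j)
      row-suc : ∀ i → applyBar A v (suc i) ≡ applyBar C (tail v) i
      row-suc i = cong (λ b → (b ∧ v zero) xor applyBar C (tail v) i)
                       (trans (cong bit (sym-A (suc i) zero)) (row-even (suc i)))

    q-cons-even : ∀ v → q A v ≡ (v zero ∧ bit α) xor q C (tail v)
    q-cons-even v = begin
      q A v
        ≡⟨ q-cons A sym-A even-A {α = α} a₀₀≡2α v ⟩
      ((v zero ∧ bit α) xor (v zero ∧ bit (firstRowDot A (lift v)))) xor q C (tail v)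
        ≡⟨ cong (λ b → ((v zero ∧ bit α) xor (v zero ∧ b)) xor q C (tail v)) row-dot-even ⟩
      ((v zero ∧ bit α) xor (v zero ∧ false)) xor q C (tail v)
        ≡⟨ cong (λ b → ((v zero ∧ bit α) xor b) xor q C (tail v)) (BoolP.∧-zeroʳ (v zero)) ⟩
      ((v zero ∧ bit α) xor false) xor q C (tail v)
        ≡⟨ cong (_xor q C (tail v)) (BoolP.xor-identityʳ (v zero ∧ bit α)) ⟩
      (v zero ∧ bit α) xor q C (tail v) ∎
      where
      open ≡-Reasoning
      row-dot-even : bit (firstRowDot A (lift v)) ≡ false
      row-dot-even = trans (bit-dot (λ j → A zero (suc j)) (tail v))
                           (xorSum-false λ j → cong (_∧ v (suc j)) (row-even (suc j)))

    det≡ : det A ≡ A zero zero * det C ⟨mod 4 ⟩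
    det≡ = det-firstRowColumn≡0 {a = 2} {b = 2} A (λ j → bit≡false⇒even (row-even (suc j)))
             λ i → bit≡false⇒even (trans (cong bit (sym-A (suc i) zero)) (row-even (suc i)))

    V0-double : length (V0bar A) ≡ length (V0bar C) ℕ.+ length (V0bar C)
    V0-double = trans (count-cons (InV0 A)) (cong₂ ℕ._+_ (count-cong λ x → InV0-cons (false ∷ x))
                                                        (count-cong λ x → InV0-cons (true ∷ x)))

    module Isotropic (α-even : bit α ≡ false) where

      q-cons-isotropic : ∀ v → q A v ≡ q C (tail v)
      q-cons-isotropic v = trans (q-cons-even v)
        (cong (_xor q C (tail v)) (trans (cong (v zero ∧_) α-even) (BoolP.∧-zeroʳ (v zero))))

      V00-double : length (V00bar A) ≡ length (V00bar C) ℕ.+ length (V00bar C)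
      V00-double = trans (count-cons (λ v → InV0 A v ∧ not (q A v)))
        (cong₂ ℕ._+_ (count-cong λ x → same-cond (false ∷ x)) (count-cong λ x → same-cond (true ∷ x)))
        where
        same-cond : ∀ v → InV0 A v ∧ not (q A v) ≡ InV0 C (tail v) ∧ not (q C (tail v))
        same-cond v = cong₂ (λ p r → p ∧ not r) (InV0-cons v) (q-cons-isotropic v)

      q-vanishes : QVanishes C → QVanishes A
      q-vanishes vanishes-C v v∈V0 = trans (q-cons-isotropic v) (vanishes-C (tail v) (trans (sym (InV0-cons v)) v∈V0))

      det≡0 : det A ≡ 0ℤ ⟨mod 4 ⟩
      det≡0 = begin
        det A                 ≈⟨ det≡ ⟩
        A zero zero * det C   ≡⟨ cong (_* det C) a₀₀≡2α ⟩
        α * + 2 * det C       ≈⟨ mod-* (mod-*ʳ (bit≡false⇒even {a = α} α-even) 2) (mod-refl {a = det C}) ⟩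
        0ℤ * det C            ≡⟨⟩
        0ℤ                    ∎
        where
        open ≡-mod-Reasoning 4

    module Anisotropic (α-odd : bit α ≡ true) where

      q-cons-anisotropic : ∀ v → q A v ≡ v zero xor q C (tail v)
      q-cons-anisotropic v = trans (q-cons-even v)
        (cong (_xor q C (tail v)) (trans (cong (v zero ∧_) α-odd) (BoolP.∧-identityʳ (v zero))))

      V00≡V0 : length (V00bar A) ≡ length (V0bar C)
      V00≡V0 = begin
        count (λ v → InV0 A v ∧ not (q A v))
          ≡⟨ count-cons (λ v → InV0 A v ∧ not (q A v)) ⟩
        count (λ x → InV0 A (false ∷ x) ∧ not (q A (false ∷ x)))
          ℕ.+ count (λ x → InV0 A (true ∷ x) ∧ not (q A (true ∷ x)))
          ≡⟨ cong₂ ℕ._+_ (count-cong λ x → cong₂ (λ p r → p ∧ not r) (InV0-cons (false ∷ x))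
                                                                    (q-cons-anisotropic (false ∷ x)))
                         (count-cong λ x → cong₂ (λ p r → p ∧ r) (InV0-cons (true ∷ x))
                                             (trans (cong not (q-cons-anisotropic (true ∷ x)))
                                                    (BoolP.not-involutive (q C x)))) ⟩
        count (λ x → InV0 C x ∧ not (q C x)) ℕ.+ count (λ x → InV0 C x ∧ q C x)
          ≡⟨ ℕP.+-comm (count (λ x → InV0 C x ∧ not (q C x))) _ ⟩
        count (λ x → InV0 C x ∧ q C x) ℕ.+ count (λ x → InV0 C x ∧ not (q C x))
          ≡⟨ count-partition (InV0 C) (q C) ⟩
        count (InV0 C) ∎
        where
        open ≡-Reasoning

      q-nonvanishing : QNonvanishing A
      q-nonvanishing = (true ∷ zeroVec) , trans (InV0-cons (true ∷ zeroVec)) (InV0-zero C)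
                                        , trans (q-cons-anisotropic (true ∷ zeroVec)) (cong not (q-zero C))

      det≡2det : det A ≡ + 2 * det C ⟨mod 4 ⟩
      det≡2det = begin
        det A                 ≈⟨ det≡ ⟩
        A zero zero * det C   ≡⟨ cong (_* det C) a₀₀≡2α ⟩
        α * + 2 * det C       ≈⟨ mod-* (mod-*ʳ (bit≡true⇒odd {a = α} α-odd) 2) (mod-refl {a = det C}) ⟩
        1ℤ * + 2 * det C      ≡⟨⟩
        + 2 * det C           ∎
        where
        open ≡-mod-Reasoning 4

  module OddPivot (A : Mat (suc (suc n))) (sym-A : Symmetric A) (even-A : EvenDiagonal A)
                  (pivot-odd : Abar A 0F 1F ≡ true) where

    a₀₀ a₀₁ a₁₀ a₁₁ δ : ℤ
    a₀₀ = A 0F 0F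
    a₀₁ = A 0F 1F
    a₁₀ = A 1F 0F
    a₁₁ = A 1F 1F
    δ = pivotDet A

    row₀ row₁ col₀ col₁ : Fin n → ℤ
    row₀ k = A 0F (suc (suc k))
    row₁ k = A 1F (suc (suc k))
    col₀ i = A (suc (suc i)) 0F
    col₁ i = A (suc (suc i)) 1F

    shift₀ shift₁ : Fin n → ℤ
    shift₀ k = schurShift₀ A (suc (suc k))
    shift₁ k = schurShift₁ A (suc (suc k))

    D : Mat n
    D i k = A (suc (suc i)) (suc (suc k))

    σ₀ σ₁ : Vec₂ n → Bool
    σ₀ x = xorSum (λ k → bit (row₀ k) ∧ x k)
    σ₁ x = xorSum (λ k → bit (row₁ k) ∧ x k)

    s₀ s₁ : Vec₂ n → ℤ
    s₀ x = sumℤ (λ k → row₀ k * lift x k)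
    s₁ x = sumℤ (λ k → row₁ k * lift x k)

    bit-s₀ : ∀ x → bit (s₀ x) ≡ σ₀ x
    bit-s₀ = bit-dot row₀

    bit-s₁ : ∀ x → bit (s₁ x) ≡ σ₁ x
    bit-s₁ = bit-dot row₁

    -- A kernel vector of Ā is determined by its tail x: its first two entries are σ₁ x and σ₀ x.
    schurLift : Vec₂ n → Vec₂ (suc (suc n))
    schurLift x = σ₁ x ∷ σ₀ x ∷ x

    α γ : ℤ
    α = proj₁ (even-quotient a₀₀ (even-A 0F))
    γ = proj₁ (even-quotient a₁₁ (even-A 1F))

    a₀₀≡2α : a₀₀ ≡ α * + 2
    a₀₀≡2α = proj₂ (even-quotient a₀₀ (even-A 0F))

    a₁₁≡2γ : a₁₁ ≡ γ * + 2
    a₁₁≡2γ = proj₂ (even-quotient a₁₁ (even-A 1F))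

    a₀₀-even : bit a₀₀ ≡ false
    a₀₀-even = even⇒bit≡false a₀₀ (even-A 0F)

    a₁₁-even : bit a₁₁ ≡ false
    a₁₁-even = even⇒bit≡false a₁₁ (even-A 1F)

    a₁₀-odd : bit a₁₀ ≡ true
    a₁₀-odd = trans (cong bit (sym-A 1F 0F)) pivot-odd

    applyBar-row₀ : ∀ v → applyBar A v 0F ≡ v 1F xor σ₀ (tail (tail v))
    applyBar-row₀ v = cong₂ (λ a b → (a ∧ v 0F) xor ((b ∧ v 1F) xor σ₀ (tail (tail v)))) a₀₀-even pivot-odd

    applyBar-row₁ : ∀ v → applyBar A v 1F ≡ v 0F xor σ₁ (tail (tail v))
    applyBar-row₁ v = cong₂ (λ a b → (a ∧ v 0F) xor ((b ∧ v 1F) xor σ₁ (tail (tail v)))) a₁₀-odd a₁₁-even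

    δ-odd : bit δ ≡ true
    δ-odd = trans (bit-minus (a₀₀ * a₁₁) (a₀₁ * a₁₀))
                         (cong₂ _xor_ (trans (bit-* a₀₀ a₁₁) (cong₂ _∧_ a₀₀-even a₁₁-even))
                                      (trans (bit-* a₀₁ a₁₀) (cong₂ _∧_ pivot-odd a₁₀-odd)))

    bit-shift₀ : ∀ k → bit (shift₀ k) ≡ bit (row₁ k)
    bit-shift₀ k = begin
      bit (- δ * (a₁₁ * row₀ k - a₀₁ * row₁ k))
        ≡⟨ bit-* (- δ) _ ⟩
      bit (- δ) ∧ bit (a₁₁ * row₀ k - a₀₁ * row₁ k)
        ≡⟨ cong₂ _∧_ (trans (bit-neg δ) δ-odd)
                     (trans (bit-minus (a₁₁ * row₀ k) (a₀₁ * row₁ k))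
                            (cong₂ _xor_ (trans (bit-* a₁₁ (row₀ k)) (cong (_∧ bit (row₀ k)) a₁₁-even))
                                         (trans (bit-* a₀₁ (row₁ k)) (cong (_∧ bit (row₁ k)) pivot-odd)))) ⟩
      true ∧ ((false ∧ bit (row₀ k)) xor (true ∧ bit (row₁ k)))
        ≡⟨⟩
      bit (row₁ k) ∎
      where
      open ≡-Reasoning

    bit-shift₁ : ∀ k → bit (shift₁ k) ≡ bit (row₀ k)
    bit-shift₁ k = begin
      bit (- δ * (a₀₀ * row₁ k - a₁₀ * row₀ k))
        ≡⟨ bit-* (- δ) _ ⟩
      bit (- δ) ∧ bit (a₀₀ * row₁ k - a₁₀ * row₀ k)
        ≡⟨ cong₂ _∧_ (trans (bit-neg δ) δ-odd)
                     (trans (bit-minus (a₀₀ * row₁ k) (a₁₀ * row₀ k))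
                            (cong₂ _xor_ (trans (bit-* a₀₀ (row₁ k)) (cong (_∧ bit (row₁ k)) a₀₀-even))
                                         (trans (bit-* a₁₀ (row₀ k)) (cong (_∧ bit (row₀ k)) a₁₀-odd)))) ⟩
      true ∧ ((false ∧ bit (row₁ k)) xor (true ∧ bit (row₀ k)))
        ≡⟨⟩
      bit (row₀ k) ∎
      where
      open ≡-Reasoning

    Abar-schur : ∀ i k → Abar (schur A) i k ≡
      (Abar D i k xor (bit (row₁ k) ∧ bit (col₀ i))) xor (bit (row₀ k) ∧ bit (col₁ i))
    Abar-schur i k = begin
      bit (D i k + shift₀ k * col₀ i + shift₁ k * col₁ i)
        ≡⟨ trans (bit-+ (D i k + shift₀ k * col₀ i) _)
                 (cong₂ _xor_ (bit-+ (D i k) _) (bit-* (shift₁ k) _)) ⟩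
      (bit (D i k) xor bit (shift₀ k * col₀ i))
        xor (bit (shift₁ k) ∧ bit (col₁ i))
        ≡⟨ cong₂ (λ p r → (bit (D i k) xor p) xor (r ∧ bit (col₁ i)))
                 (trans (bit-* (shift₀ k) _) (cong (_∧ bit (col₀ i)) (bit-shift₀ k)))
                 (bit-shift₁ k) ⟩
      (Abar D i k xor (bit (row₁ k) ∧ bit (col₀ i))) xor (bit (row₀ k) ∧ bit (col₁ i)) ∎
      where
      open ≡-Reasoning

    applyBar-schur : ∀ x i → applyBar (schur A) x i ≡ applyBar A (schurLift x) (suc (suc i))
    applyBar-schur x i = begin
      xorSum (λ k → Abar (schur A) i k ∧ x k)
        ≡⟨ xorSum-cong (λ k → trans (cong (_∧ x k) (Abar-schur i k))
                                    (distribute (Abar D i k) (bit (row₁ k)) a (bit (row₀ k)) b (x k))) ⟩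
      xorSum (λ k → ((Abar D i k ∧ x k) xor (a ∧ (bit (row₁ k) ∧ x k))) xor (b ∧ (bit (row₀ k) ∧ x k)))
        ≡⟨ trans (xorSum-xor (λ k → (Abar D i k ∧ x k) xor (a ∧ (bit (row₁ k) ∧ x k)))
                             (λ k → b ∧ (bit (row₀ k) ∧ x k)))
                 (cong₂ _xor_ (xorSum-xor (λ k → Abar D i k ∧ x k) (λ k → a ∧ (bit (row₁ k) ∧ x k)))
                              (xorSum-∧ˡ b (λ k → bit (row₀ k) ∧ x k))) ⟩
      (applyBar D x i xor xorSum (λ k → a ∧ (bit (row₁ k) ∧ x k))) xor (b ∧ σ₀ x)
        ≡⟨ cong (λ p → (applyBar D x i xor p) xor (b ∧ σ₀ x)) (xorSum-∧ˡ a (λ k → bit (row₁ k) ∧ x k)) ⟩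
      (applyBar D x i xor (a ∧ σ₁ x)) xor (b ∧ σ₀ x)
        ≡⟨ rotate (applyBar D x i) (a ∧ σ₁ x) (b ∧ σ₀ x) ⟩
      (a ∧ σ₁ x) xor ((b ∧ σ₀ x) xor applyBar D x i) ∎
      where
      open ≡-Reasoning
      open xor-∧-Solver
      a b : Bool
      a = bit (col₀ i)
      b = bit (col₁ i)
      distribute : ∀ d r a′ p b′ y →
        ((d xor (r ∧ a′)) xor (p ∧ b′)) ∧ y ≡ ((d ∧ y) xor (a′ ∧ (r ∧ y))) xor (b′ ∧ (p ∧ y))
      distribute = solve 6 (λ d r a′ p b′ y → ((d :+ (r :* a′)) :+ (p :* b′)) :* y
                                            := ((d :* y) :+ (a′ :* (r :* y))) :+ (b′ :* (p :* y))) refl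
      rotate : ∀ d p r → (d xor p) xor r ≡ p xor (r xor d)
      rotate = solve 3 (λ d p r → (d :+ p) :+ r := p :+ (r :+ d)) refl

    InV0-schurLift : ∀ x → InV0 A (schurLift x) ≡ InV0 (schur A) x
    InV0-schurLift x = begin
      not (applyBar A (schurLift x) 0F) ∧ (not (applyBar A (schurLift x) 1F) ∧ rest)
        ≡⟨ cong₂ (λ p r → not p ∧ (not r ∧ rest))
                 (trans (applyBar-row₀ (schurLift x)) (BoolP.xor-same (σ₀ x)))
                 (trans (applyBar-row₁ (schurLift x)) (BoolP.xor-same (σ₁ x))) ⟩
      rest
        ≡⟨ allᵇ-cong (λ i → cong not (applyBar-schur x i)) ⟨
      InV0 (schur A) x ∎
      where
      open ≡-Reasoning
      rest : Bool
      rest = allᵇ (λ i → not (applyBar A (schurLift x) (suc (suc i))))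

    kernel-head : ∀ v → InV0 A v ≡ true → v ≗ schurLift (tail (tail v))
    kernel-head v v∈V0 zero          = xnor⇒≡ (v 0F) (σ₁ (tail (tail v))) (trans (cong not (sym (applyBar-row₁ v))) (row 1F))
      where
      row : ∀ i → not (applyBar A v i) ≡ true
      row = allᵇ⇒ {f = λ i → not (applyBar A v i)} v∈V0
    kernel-head v v∈V0 (suc zero)    = xnor⇒≡ (v 1F) (σ₀ (tail (tail v))) (trans (cong not (sym (applyBar-row₀ v))) (row 0F))
      where
      row : ∀ i → not (applyBar A v i) ≡ true
      row = allᵇ⇒ {f = λ i → not (applyBar A v i)} v∈V0
    kernel-head v v∈V0 (suc (suc k)) = refl

    count-schur : (E : Vec₂ (suc (suc n)) → Bool) →
      count (λ v → InV0 A v ∧ E v) ≡ count (λ x → InV0 (schur A) x ∧ E (schurLift x))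
    count-schur E = begin
      count (λ v → InV0 A v ∧ E v)
        ≡⟨ count-graph (σ₁ ∘ tail) R (λ v → InV0 A v ∧ E v) split-head ⟩
      count (λ y → R (σ₁ (tail y)) y)
        ≡⟨ count-graph σ₀ (λ u x → rest (σ₁ x ∷ u ∷ x) ∧ E (σ₁ x ∷ u ∷ x)) (λ y → R (σ₁ (tail y)) y)
                       (λ _ _ → refl) ⟩
      count (λ x → rest (schurLift x) ∧ E (schurLift x))
        ≡⟨ count-cong (λ x → cong (_∧ E (schurLift x)) (allᵇ-cong λ i → cong not (applyBar-schur x i))) ⟨
      count (λ x → InV0 (schur A) x ∧ E (schurLift x)) ∎
      where
      open ≡-Reasoning
      rest : Vec₂ (suc (suc n)) → Bool
      rest v = allᵇ (λ i → not (applyBar A v (suc (suc i))))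
      R : Bool → Vec₂ (suc n) → Bool
      R u y = not (head y xor σ₀ (tail y)) ∧ (rest (u ∷ y) ∧ E (u ∷ y))
      reorder : ∀ a b c e → (a ∧ (b ∧ c)) ∧ e ≡ b ∧ (a ∧ (c ∧ e))
      reorder = solve 4 (λ a b c e → (a :* (b :* c)) :* e := b :* (a :* (c :* e))) refl
        where
        open xor-∧-Solver
      split-head : ∀ u y → InV0 A (u ∷ y) ∧ E (u ∷ y) ≡ not (u xor σ₁ (tail y)) ∧ R u y
      split-head u y = trans
        (cong₂ (λ p r → (not p ∧ (not r ∧ rest (u ∷ y))) ∧ E (u ∷ y))
               (applyBar-row₀ (u ∷ y)) (applyBar-row₁ (u ∷ y)))
        (reorder (not (head y xor σ₀ (tail y))) (not (u xor σ₁ (tail y))) (rest (u ∷ y)) (E (u ∷ y)))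

    V0-same : length (V0bar A) ≡ length (V0bar (schur A))
    V0-same = begin
      count (InV0 A)                               ≡⟨ count-cong (λ v → BoolP.∧-identityʳ (InV0 A v)) ⟨
      count (λ v → InV0 A v ∧ true)                ≡⟨ count-schur (λ _ → true) ⟩
      count (λ x → InV0 (schur A) x ∧ true)        ≡⟨ count-cong (λ x → BoolP.∧-identityʳ (InV0 (schur A) x)) ⟩
      count (InV0 (schur A))                       ∎
      where
      open ≡-Reasoning

    D-symmetric : Symmetric D
    D-symmetric i k = sym-A (suc (suc i)) (suc (suc k))

    D-evenDiagonal : EvenDiagonal D
    D-evenDiagonal i = even-A (suc (suc i))

    shift-dot : ∀ c b (u w : Fin n → ℤ) x → sumℤ (λ k → - δ * (c * u k - b * w k) * lift x k)
                                         ≡ - δ * (c * sumℤ (λ k → u k * lift x k) - b * sumℤ (λ k → w k * lift x k))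
    shift-dot c b u w x = begin
      sumℤ (λ k → - δ * (c * u k - b * w k) * lift x k)
        ≡⟨ sumℤ-cong (λ k → spread δ c b (u k) (w k) (lift x k)) ⟩
      sumℤ (λ k → (- δ * c) * (u k * lift x k) + (δ * b) * (w k * lift x k))
        ≡⟨ sumℤ-linear (- δ * c) (δ * b) (λ k → u k * lift x k) (λ k → w k * lift x k) ⟩
      (- δ * c) * sumℤ (λ k → u k * lift x k) + (δ * b) * sumℤ (λ k → w k * lift x k)
        ≡⟨ gather δ c b (sumℤ (λ k → u k * lift x k)) (sumℤ (λ k → w k * lift x k)) ⟩
      - δ * (c * sumℤ (λ k → u k * lift x k) - b * sumℤ (λ k → w k * lift x k)) ∎
      where
      open ≡-Reasoning
      spread : ∀ d c b p r y → - d * (c * p - b * r) * y ≡ (- d * c) * (p * y) + (d * b) * (r * y)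
      spread = solve-∀
      gather : ∀ d c b s t → (- d * c) * s + (d * b) * t ≡ - d * (c * s - b * t)
      gather = solve-∀

    binaryQuadratic : Vec₂ n → ℤ
    binaryQuadratic x = γ * (s₀ x * s₀ x) - a₀₁ * (s₀ x * s₁ x) + α * (s₁ x * s₁ x)

    form-schur : ∀ x {G} → form D (lift x) (lift x) ≡ G * + 2 →
      form (schur A) (lift x) (lift x) ≡ (G + - δ * binaryQuadratic x) * + 2
    form-schur x {G} form-D≡2G = begin
      form (schur A) y y
        ≡⟨ form-addOuter D₀ col₁ shift₁ y ⟩
      form D₀ y y + sumℤ (λ i → y i * col₁ i) * sumℤ (λ k → shift₁ k * y k)
        ≡⟨ cong (_+ sumℤ (λ i → y i * col₁ i) * sumℤ (λ k → shift₁ k * y k))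
                (form-addOuter D col₀ shift₀ y) ⟩
      form D y y + sumℤ (λ i → y i * col₀ i) * sumℤ (λ k → shift₀ k * y k)
                 + sumℤ (λ i → y i * col₁ i) * sumℤ (λ k → shift₁ k * y k)
        ≡⟨ cong₂ (λ p r → form D y y + p + r) (cong₂ _*_ (column-dot 0F) (shift-dot a₁₁ a₀₁ row₀ row₁ x))
                                              (cong₂ _*_ (column-dot 1F) (shift-dot a₀₀ a₁₀ row₁ row₀ x)) ⟩
      form D y y + s₀ x * (- δ * (a₁₁ * s₀ x - a₀₁ * s₁ x)) + s₁ x * (- δ * (a₀₀ * s₁ x - a₁₀ * s₀ x))
        ≡⟨ cong₂ (λ f c → f + s₀ x * (- δ * (c * s₀ x - a₀₁ * s₁ x)) + s₁ x * (- δ * (a₀₀ * s₁ x - a₁₀ * s₀ x)))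
                 form-D≡2G a₁₁≡2γ ⟩
      G * + 2 + s₀ x * (- δ * ((γ * + 2) * s₀ x - a₀₁ * s₁ x)) + s₁ x * (- δ * (a₀₀ * s₁ x - a₁₀ * s₀ x))
        ≡⟨ cong₂ (λ a b → G * + 2 + s₀ x * (- δ * ((γ * + 2) * s₀ x - a₀₁ * s₁ x)) + s₁ x * (- δ * (a * s₁ x - b * s₀ x)))
                 a₀₀≡2α (sym-A 1F 0F) ⟩
      G * + 2 + s₀ x * (- δ * ((γ * + 2) * s₀ x - a₀₁ * s₁ x)) + s₁ x * (- δ * ((α * + 2) * s₁ x - a₀₁ * s₀ x))
        ≡⟨ halve G δ α γ a₀₁ (s₀ x) (s₁ x) ⟩
      (G + - δ * binaryQuadratic x) * + 2 ∎
      where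
      open ≡-Reasoning
      y : Fin n → ℤ
      y = lift x
      D₀ : Mat n
      D₀ i k = D i k + shift₀ k * col₀ i
      column-dot : ∀ c → sumℤ (λ i → y i * A (suc (suc i)) c) ≡ sumℤ (λ k → A c (suc (suc k)) * y k)
      column-dot c = sumℤ-cong λ i → trans (cong (y i *_) (sym-A (suc (suc i)) c)) (ℤP.*-comm (y i) _)
      halve : ∀ G d α γ b s t → G * + 2 + s * (- d * ((γ * + 2) * s - b * t)) + t * (- d * ((α * + 2) * t - b * s))
                              ≡ (G + - d * (γ * (s * s) - b * (s * t) + α * (t * t))) * + 2
      halve = solve-∀

    q-schur : ∀ x → q (schur A) x ≡ q D x xor (((bit γ ∧ σ₀ x) xor (σ₀ x ∧ σ₁ x)) xor (bit α ∧ σ₁ x))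
    q-schur x with G , form-D≡2G ← form-even D D-symmetric D-evenDiagonal (lift x) = begin
      q (schur A) x
        ≡⟨ q-half (schur A) x {G = G + - δ * binaryQuadratic x} (form-schur x {G = G} form-D≡2G) ⟩
      bit (G + - δ * binaryQuadratic x)
        ≡⟨ trans (bit-+ G (- δ * binaryQuadratic x))
                 (cong₂ _xor_ (sym (q-half D x {G = G} form-D≡2G)) (bit-* (- δ) (binaryQuadratic x))) ⟩
      q D x xor (bit (- δ) ∧ bit (binaryQuadratic x))
        ≡⟨ cong (λ d → q D x xor (d ∧ bit (binaryQuadratic x))) (trans (bit-neg δ) δ-odd) ⟩
      q D x xor bit (binaryQuadratic x)
        ≡⟨ cong (q D x xor_) (bit-binaryQuadratic γ a₀₁ α (s₀ x) (s₁ x)) ⟩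
      q D x xor (((bit γ ∧ bit (s₀ x)) xor (bit a₀₁ ∧ (bit (s₀ x) ∧ bit (s₁ x)))) xor (bit α ∧ bit (s₁ x)))
        ≡⟨ cong₂ (λ p r → q D x xor (((bit γ ∧ p) xor (bit a₀₁ ∧ (p ∧ r))) xor (bit α ∧ r)))
                 (bit-s₀ x) (bit-s₁ x) ⟩
      q D x xor (((bit γ ∧ σ₀ x) xor (bit a₀₁ ∧ (σ₀ x ∧ σ₁ x))) xor (bit α ∧ σ₁ x))
        ≡⟨ cong (λ b → q D x xor (((bit γ ∧ σ₀ x) xor (b ∧ (σ₀ x ∧ σ₁ x))) xor (bit α ∧ σ₁ x)))
                pivot-odd ⟩
      q D x xor (((bit γ ∧ σ₀ x) xor (σ₀ x ∧ σ₁ x)) xor (bit α ∧ σ₁ x)) ∎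
      where
      open ≡-Reasoning

    q-schurLift : ∀ x → q A (schurLift x) ≡ q (schur A) x
    q-schurLift x = begin
      q A (schurLift x)
        ≡⟨ q-cons A sym-A even-A {α = α} a₀₀≡2α (schurLift x) ⟩
      ((σ₁ x ∧ bit α) xor (σ₁ x ∧ bit (firstRowDot A (lift (schurLift x))))) xor q A′ (σ₀ x ∷ x)
        ≡⟨ cong₂ (λ p r → ((σ₁ x ∧ bit α) xor (σ₁ x ∧ p)) xor r) row₀-dot
                 (q-cons A′ (minor-symmetric A sym-A) (minor-evenDiagonal A even-A) {α = γ} a₁₁≡2γ (σ₀ x ∷ x)) ⟩
      ((σ₁ x ∧ bit α) xor (σ₁ x ∧ (σ₀ x xor σ₀ x))) xor (((σ₀ x ∧ bit γ) xor (σ₀ x ∧ bit (s₁ x))) xor q D x)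
        ≡⟨ cong (λ p → ((σ₁ x ∧ bit α) xor (σ₁ x ∧ (σ₀ x xor σ₀ x)))
                         xor (((σ₀ x ∧ bit γ) xor (σ₀ x ∧ p)) xor q D x))
                (bit-s₁ x) ⟩
      ((σ₁ x ∧ bit α) xor (σ₁ x ∧ (σ₀ x xor σ₀ x))) xor (((σ₀ x ∧ bit γ) xor (σ₀ x ∧ σ₁ x)) xor q D x)
        ≡⟨ collect (σ₀ x) (σ₁ x) (bit α) (bit γ) (q D x) ⟩
      q D x xor (((bit γ ∧ σ₀ x) xor (σ₀ x ∧ σ₁ x)) xor (bit α ∧ σ₁ x))
        ≡⟨ q-schur x ⟨
      q (schur A) x ∎
      where
      open ≡-Reasoning
      A′ : Mat (suc n)
      A′ = minor A 0F
      row₀-dot : bit (firstRowDot A (lift (schurLift x))) ≡ σ₀ x xor σ₀ x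
      row₀-dot = begin
        bit (a₀₁ * toℤ (σ₀ x) + s₀ x)
          ≡⟨ bit-+ (a₀₁ * toℤ (σ₀ x)) (s₀ x) ⟩
        bit (a₀₁ * toℤ (σ₀ x)) xor bit (s₀ x)
          ≡⟨ cong₂ _xor_ (trans (bit-* a₀₁ (toℤ (σ₀ x))) (cong₂ _∧_ pivot-odd (bit-toℤ (σ₀ x)))) (bit-s₀ x) ⟩
        σ₀ x xor σ₀ x ∎
      collect : ∀ s t a g d → ((t ∧ a) xor (t ∧ (s xor s))) xor (((s ∧ g) xor (s ∧ t)) xor d)
                            ≡ d xor (((g ∧ s) xor (s ∧ t)) xor (a ∧ t))
      collect = solve 5 (λ s t a g d → ((t :* a) :+ (t :* (s :+ s))) :+ (((s :* g) :+ (s :* t)) :+ d)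
                                     := d :+ (((g :* s) :+ (s :* t)) :+ (a :* t))) refl
        where
        open xor-∧-Solver

    V00-same : length (V00bar A) ≡ length (V00bar (schur A))
    V00-same = trans (count-schur (λ v → not (q A v)))
                     (count-cong λ x → cong (λ r → InV0 (schur A) x ∧ not r) (q-schurLift x))

    q-vanishes : QVanishes (schur A) → QVanishes A
    q-vanishes vanishes-C v v∈V0 = begin
      q A v                    ≡⟨ q-resp A (kernel-head v v∈V0) ⟩
      q A (schurLift x)        ≡⟨ q-schurLift x ⟩
      q (schur A) x            ≡⟨ vanishes-C x x∈V0 ⟩
      false                    ∎
      where
      open ≡-Reasoning
      x : Vec₂ n
      x = tail (tail v)
      x∈V0 : InV0 (schur A) x ≡ true
      x∈V0 = trans (sym (InV0-schurLift x)) (trans (sym (InV0-resp A (kernel-head v v∈V0))) v∈V0)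

    q-nonvanishing : QNonvanishing (schur A) → QNonvanishing A
    q-nonvanishing (x , x∈V0 , qx≡1) = schurLift x , trans (InV0-schurLift x) x∈V0 , trans (q-schurLift x) qx≡1

    pivotDet≡-1 : δ ≡ -1ℤ ⟨mod 4 ⟩
    pivotDet≡-1 with β , a₀₁≡1+2β ← mod-quotient (bit≡true⇒odd {a = a₀₁} pivot-odd) = begin
      a₀₀ * a₁₁ - a₀₁ * a₁₀     ≡⟨ cong₂ (λ p r → p - a₀₁ * r) (cong₂ _*_ a₀₀≡2α a₁₁≡2γ) (sym-A 1F 0F) ⟩
      (α * + 2) * (γ * + 2) - a₀₁ * a₀₁       ≡⟨ cong (λ c → (α * + 2) * (γ * + 2) - c * c) a₀₁≡1+2β ⟩
      (α * + 2) * (γ * + 2) - (1ℤ + β * + 2) * (1ℤ + β * + 2)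
                                          ≈⟨ mod-by (α * γ - β - β * β) (expand α β γ) ⟩
      -1ℤ                                 ∎
      where
      open ≡-mod-Reasoning 4
      expand : ∀ α β γ → (α * + 2) * (γ * + 2) - (1ℤ + β * + 2) * (1ℤ + β * + 2)
                         ≡ -1ℤ + (α * γ - β - β * β) * + 4
      expand = solve-∀

    det≡-det-schur : det A ≡ - det (schur A) ⟨mod 4 ⟩
    det≡-det-schur = begin
      det A                ≈⟨ det-schur A (mod-* pivotDet≡-1 pivotDet≡-1) ⟩
      δ * det (schur A)    ≈⟨ mod-* pivotDet≡-1 (mod-refl {a = det (schur A)}) ⟩
      -1ℤ * det (schur A)  ≡⟨ ℤP.-1*i≡-i (det (schur A)) ⟩
      - det (schur A)      ∎
      where
      open ≡-mod-Reasoning 4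

    correction : Fin n → Fin n → ℤ
    correction i k = a₁₁ * row₀ i * row₀ k - a₀₁ * (row₀ i * row₁ k + row₁ i * row₀ k) + a₀₀ * row₁ i * row₁ k

    schur-entry : ∀ i k → schur A i k ≡ D i k - δ * correction i k
    schur-entry i k = begin
      D i k + (- δ * (a₁₁ * row₀ k - a₀₁ * row₁ k)) * col₀ i + (- δ * (a₀₀ * row₁ k - a₁₀ * row₀ k)) * col₁ i
        ≡⟨ subst-entries (sym-A (suc (suc i)) 0F) (sym-A (suc (suc i)) 1F) (sym-A 1F 0F) ⟩
      D i k + (- δ * (a₁₁ * row₀ k - a₀₁ * row₁ k)) * row₀ i + (- δ * (a₀₀ * row₁ k - a₀₁ * row₀ k)) * row₁ i
        ≡⟨ expand (D i k) δ a₀₀ a₀₁ a₁₁ (row₀ i) (row₀ k) (row₁ i) (row₁ k) ⟩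
      D i k - δ * correction i k ∎
      where
      open ≡-Reasoning
      subst-entries : ∀ {u u′ w w′ b b′} → u ≡ u′ → w ≡ w′ → b ≡ b′ →
        D i k + (- δ * (a₁₁ * row₀ k - a₀₁ * row₁ k)) * u + (- δ * (a₀₀ * row₁ k - b * row₀ k)) * w
          ≡ D i k + (- δ * (a₁₁ * row₀ k - a₀₁ * row₁ k)) * u′ + (- δ * (a₀₀ * row₁ k - b′ * row₀ k)) * w′
      subst-entries refl refl refl = refl
      expand : ∀ d δ a b c pᵢ pₖ rᵢ rₖ → d + (- δ * (c * pₖ - b * rₖ)) * pᵢ + (- δ * (a * rₖ - b * pₖ)) * rᵢ
                                        ≡ d - δ * (c * pᵢ * pₖ - b * (pᵢ * rₖ + rᵢ * pₖ) + a * rᵢ * rₖ)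
      expand = solve-∀

    schur-symmetric : Symmetric (schur A)
    schur-symmetric i k = begin
      schur A i k                 ≡⟨ schur-entry i k ⟩
      D i k - δ * correction i k  ≡⟨ cong₂ (λ d t → d - δ * t) (D-symmetric i k)
                                            (swap a₁₁ a₀₁ a₀₀ (row₀ i) (row₀ k) (row₁ i) (row₁ k)) ⟩
      D k i - δ * correction k i  ≡⟨ schur-entry k i ⟨
      schur A k i                 ∎
      where
      open ≡-Reasoning
      swap : ∀ c b a pᵢ pₖ rᵢ rₖ → c * pᵢ * pₖ - b * (pᵢ * rₖ + rᵢ * pₖ) + a * rᵢ * rₖ
                                ≡ c * pₖ * pᵢ - b * (pₖ * rᵢ + rₖ * pᵢ) + a * rₖ * rᵢ
      swap = solve-∀

    schur-evenDiagonal : EvenDiagonal (schur A)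
    schur-evenDiagonal i with h , Dᵢᵢ≡2h ← even-quotient (D i i) (D-evenDiagonal i) =
      ∣⇒∣ᵤ (divides (h - δ * half) (begin
        schur A i i                              ≡⟨ schur-entry i i ⟩
        D i i - δ * correction i i               ≡⟨ cong₂ (λ d t → d - δ * t) Dᵢᵢ≡2h correction-even ⟩
        h * + 2 - δ * (half * + 2)               ≡⟨ factor h δ half ⟩
        (h - δ * half) * + 2                     ∎))
      where
      open ≡-Reasoning
      half : ℤ
      half = γ * row₀ i * row₀ i - a₀₁ * row₀ i * row₁ i + α * row₁ i * row₁ i
      correction-even : correction i i ≡ half * + 2
      correction-even = trans (cong₂ (λ c a → c * row₀ i * row₀ i - a₀₁ * (row₀ i * row₁ i + row₁ i * row₀ i)
                                              + a * row₁ i * row₁ i)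
                                     a₁₁≡2γ a₀₀≡2α)
                              (halve γ a₀₁ α (row₀ i) (row₁ i))
        where
        halve : ∀ γ b α p r → (γ * + 2) * p * p - b * (p * r + r * p) + (α * + 2) * r * r
                              ≡ (γ * p * p - b * p * r + α * r * r) * + 2
        halve = solve-∀
      factor : ∀ h δ t → h * + 2 - δ * (t * + 2) ≡ (h - δ * t) * + 2
      factor = solve-∀

  module Transposition (A : Mat n) (c d : Fin n) where

    τ : Fin n → Fin n
    τ = PC.transpose c d

    τ-involutive : ∀ i → τ (τ i) ≡ i
    τ-involutive = transpose-involutive c d

    permute-involutive : (v : Vec₂ n) → (v ∘ τ) ∘ τ ≗ v
    permute-involutive v i = cong v (τ-involutive i)

    allᵇ-τ : (f : Fin n → Bool) → allᵇ (f ∘ τ) ≡ allᵇ f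
    allᵇ-τ f = Bool-≡
      (λ all-fτ → ⇒allᵇ λ i → trans (cong f (sym (τ-involutive i))) (allᵇ⇒ {f = f ∘ τ} all-fτ (τ i)))
      (λ all-f → ⇒allᵇ λ i → allᵇ⇒ {f = f} all-f (τ i))

    applyBar-conjugate : ∀ v i → applyBar (conjugate A c d) v i ≡ applyBar A (v ∘ τ) (τ i)
    applyBar-conjugate v i = begin
      applyBar (conjugate A c d) v i
        ≡⟨ bit-dot (λ j → A (τ i) (τ j)) v ⟨
      bit (sumℤ (λ j → A (τ i) (τ j) * lift v j))
        ≡⟨ cong bit (sumℤ-cong λ j → cong (λ k → A (τ i) (τ j) * toℤ (v k)) (sym (τ-involutive j))) ⟩
      bit (sumℤ (λ j → A (τ i) (τ j) * lift (v ∘ τ) (τ j)))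
        ≡⟨ cong bit (sumℤ-transpose c d (λ k → A (τ i) k * lift (v ∘ τ) k)) ⟩
      bit (sumℤ (λ k → A (τ i) k * lift (v ∘ τ) k))
        ≡⟨ bit-dot (A (τ i)) (v ∘ τ) ⟩
      applyBar A (v ∘ τ) (τ i) ∎
      where
      open ≡-Reasoning

    InV0-conjugate : ∀ v → InV0 (conjugate A c d) v ≡ InV0 A (v ∘ τ)
    InV0-conjugate v = trans (allᵇ-cong λ i → cong not (applyBar-conjugate v i))
                             (allᵇ-τ λ i → not (applyBar A (v ∘ τ) i))

    form-conjugate : ∀ (y : Fin n → ℤ) → form (conjugate A c d) y y ≡ form A (y ∘ τ) (y ∘ τ)
    form-conjugate y = begin
      sumℤ (λ i → sumℤ (λ j → y i * A (τ i) (τ j) * y j))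
        ≡⟨ sumℤ-cong (λ i → sumℤ-cong λ j → cong₂ (λ k l → y k * A (τ i) (τ j) * y l)
                                                   (sym (τ-involutive i)) (sym (τ-involutive j))) ⟩
      sumℤ (λ i → sumℤ (λ j → y (τ (τ i)) * A (τ i) (τ j) * y (τ (τ j))))
        ≡⟨ sumℤ-cong (λ i → sumℤ-transpose c d (λ l → y (τ (τ i)) * A (τ i) l * y (τ l))) ⟩
      sumℤ (λ i → sumℤ (λ l → y (τ (τ i)) * A (τ i) l * y (τ l)))
        ≡⟨ sumℤ-transpose c d (λ k → sumℤ (λ l → y (τ k) * A k l * y (τ l))) ⟩
      form A (y ∘ τ) (y ∘ τ) ∎
      where
      open ≡-Reasoning

    q-conjugate : ∀ v → q (conjugate A c d) v ≡ q A (v ∘ τ)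
    q-conjugate v = cong (λ F → ((∣ F ∣ ℕ./ 2) ℕ.% 2) ℕ.≡ᵇ 1) (form-conjugate (lift v))

    count-permute : (P : Vec₂ n → Bool) → Respects≗ P → count (λ v → P (v ∘ τ)) ≡ count P
    count-permute P P-resp = count-involution P P-resp (_∘ τ) (λ v≗w i → v≗w (τ i)) permute-involutive

    V0-same : length (V0bar (conjugate A c d)) ≡ length (V0bar A)
    V0-same = trans (count-cong InV0-conjugate) (count-permute (InV0 A) (InV0-resp A))

    V00-same : length (V00bar (conjugate A c d)) ≡ length (V00bar A)
    V00-same = trans (count-cong λ v → cong₂ (λ p r → p ∧ not r) (InV0-conjugate v) (q-conjugate v))
                     (count-permute (λ v → InV0 A v ∧ not (q A v))
                                    (λ v≗w → cong₂ (λ p r → p ∧ not r) (InV0-resp A v≗w) (q-resp A v≗w)))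

    q-vanishes : QVanishes (conjugate A c d) → QVanishes A
    q-vanishes vanishes-A′ v v∈V0 = begin
      q A v                          ≡⟨ q-resp A (permute-involutive v) ⟨
      q A ((v ∘ τ) ∘ τ)              ≡⟨ q-conjugate (v ∘ τ) ⟨
      q (conjugate A c d) (v ∘ τ)    ≡⟨ vanishes-A′ (v ∘ τ) (trans (InV0-conjugate (v ∘ τ))
                                                                   (trans (InV0-resp A (permute-involutive v)) v∈V0)) ⟩
      false                          ∎
      where
      open ≡-Reasoning

    q-nonvanishing : QNonvanishing (conjugate A c d) → QNonvanishing A
    q-nonvanishing (v , v∈V0 , qv≡1) = v ∘ τ , trans (sym (InV0-conjugate v)) v∈V0 , trans (sym (q-conjugate v)) qv≡1

module Mod4Classification where

  open import Defs
  open Arithmetic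
  open Determinant
  open Counting
  open QuadraticForm
  open Reduction
  open import Data.Bool using (Bool; true; false)
  import Data.Bool.Properties as BoolP
  open import Data.Empty using (⊥-elim)
  open import Data.Fin using (Fin; zero; suc)
  open import Data.Fin.Patterns using (0F; 1F)
  import Data.Fin.Permutation.Components as PC
  import Data.Fin.Properties as FinP
  open import Data.Integer using (ℤ; +_; 0ℤ; 1ℤ; -1ℤ; _*_; -_)
  import Data.Integer.Properties as ℤP
  open import Data.List using (length)
  open import Data.Nat as ℕ using (ℕ; zero; suc; _≤_; _<_; _∸_; _%_; _^_; s≤s; z≤n)
  open import Data.Nat.DivMod using (%-distribˡ-+; m∣n⇒o%n%m≡o%m)
  import Data.Nat.Divisibility as ℕ∣
  import Data.Nat.Properties as ℕP
  open import Data.Product using (∃; _,_; _×_; proj₁; proj₂)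
  open import Data.Sum as Sum using (_⊎_; inj₁; inj₂)
  open import Function.Bundles using (_⇔_; mk⇔; Equivalence)
  open import Relation.Binary.PropositionalEquality
  open import Relation.Nullary using (yes; no; ¬_)

  private
    variable
      n m : ℕ

  -- (-1)^⌊n/2⌋, the determinant of an orthogonal sum of ⌊n/2⌋ hyperbolic planes.
  hyperbolicSign : ℕ → ℤ
  hyperbolicSign zero          = 1ℤ
  hyperbolicSign (suc zero)    = 1ℤ
  hyperbolicSign (suc (suc n)) = - hyperbolicSign n

  hyperbolicSign-unit : ∀ n → hyperbolicSign n ≡ 1ℤ ⊎ hyperbolicSign n ≡ -1ℤ
  hyperbolicSign-unit zero          = inj₁ refl
  hyperbolicSign-unit (suc zero)    = inj₁ refl
  hyperbolicSign-unit (suc (suc n)) with hyperbolicSign-unit n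
  ... | inj₁ s≡1  = inj₂ (cong -_ s≡1)
  ... | inj₂ s≡-1 = inj₁ (cong -_ s≡-1)

  hyperbolicSign≡1 : ∀ n → n % 4 ≡ 0 → hyperbolicSign n ≡ 1ℤ
  hyperbolicSign≡1 0 _ = refl
  hyperbolicSign≡1 1 ()
  hyperbolicSign≡1 2 ()
  hyperbolicSign≡1 3 ()
  hyperbolicSign≡1 (suc (suc (suc (suc n)))) n%4≡0 = trans (ℤP.neg-involutive _) (hyperbolicSign≡1 n n%4≡0)

  hyperbolicSign≡-1 : ∀ n → n % 4 ≡ 2 → hyperbolicSign n ≡ -1ℤ
  hyperbolicSign≡-1 0 ()
  hyperbolicSign≡-1 1 ()
  hyperbolicSign≡-1 2 _ = refl
  hyperbolicSign≡-1 3 ()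
  hyperbolicSign≡-1 (suc (suc (suc (suc n)))) n%4≡2 = trans (ℤP.neg-involutive _) (hyperbolicSign≡-1 n n%4≡2)

  unit*2≡2 : ∀ {σ} → σ ≡ 1ℤ ⊎ σ ≡ -1ℤ → σ * + 2 ≡ + 2 ⟨mod 4 ⟩
  unit*2≡2 (inj₁ refl) = mod-refl
  unit*2≡2 (inj₂ refl) = mod-by -1ℤ refl

  even⇒suc-odd : ∀ n → n % 2 ≡ 0 → suc n % 2 ≡ 1
  even⇒suc-odd n n%2≡0 = trans (%-distribˡ-+ 1 n 2) (cong (λ r → (1 ℕ.+ r) % 2) n%2≡0)

  odd⇒positive : n % 2 ≡ 1 → 1 ≤ n
  odd⇒positive {suc n} _ = s≤s z≤n

  %4⇒%2 : ∀ n {k} → n % 4 ≡ k → n % 2 ≡ k % 2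
  %4⇒%2 n n%4≡k = trans (sym (m∣n⇒o%n%m≡o%m 2 4 n (ℕ∣.divides 2 refl))) (cong (_% 2) n%4≡k)

  doubled : ∀ d {a b} → a ≡ b ℕ.+ b → b ≡ 2 ^ d → a ≡ 2 ^ suc d
  doubled d a≡b+b b≡2^d =
    trans a≡b+b (trans (cong₂ ℕ._+_ b≡2^d b≡2^d) (cong (2 ^ d ℕ.+_) (sym (ℕP.+-identityʳ (2 ^ d)))))

  ±1≢2 : ∀ {x} → x ≡ 1ℤ ⟨mod 4 ⟩ ⊎ x ≡ -1ℤ ⟨mod 4 ⟩ → ¬ (x ≡ + 2 ⟨mod 4 ⟩)
  ±1≢2 (inj₁ x≡1)  x≡2 = ¬mod-small (s≤s (s≤s z≤n)) (mod-trans (mod-sym x≡1) x≡2)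
  ±1≢2 (inj₂ x≡-1) x≡2 = ¬mod-small ℕP.≤-refl (mod-trans (mod-sym x≡-1) x≡2)

  ±1≢0 : ∀ {x} → x ≡ 1ℤ ⟨mod 4 ⟩ ⊎ x ≡ -1ℤ ⟨mod 4 ⟩ → ¬ (x ≡ 0ℤ ⟨mod 4 ⟩)
  ±1≢0 (inj₁ x≡1)  x≡0 = ¬mod-small (s≤s (s≤s z≤n)) (mod-trans (mod-sym x≡1) x≡0)
  ±1≢0 (inj₂ x≡-1) x≡0 = ¬mod-small (s≤s (s≤s z≤n)) (mod-trans (mod-sym x≡-1) x≡0)

  2≢0 : ∀ {x} → x ≡ + 2 ⟨mod 4 ⟩ → ¬ (x ≡ 0ℤ ⟨mod 4 ⟩)
  2≢0 x≡2 x≡0 = ¬mod-small (s≤s (s≤s (s≤s z≤n))) (mod-trans (mod-sym x≡2) x≡0)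

  record Nonsingular (A : Mat n) : Set where
    field
      size-even   : n % 2 ≡ 0
      det≡sign    : det A ≡ hyperbolicSign n ⟨mod 4 ⟩
      V0-trivial  : HasDim (V0bar A) 0
      V00-trivial : HasDim (V00bar A) 0
      q-vanishes  : QVanishes A

  record AnisotropicRadical (A : Mat n) : Set where
    field
      size-odd       : n % 2 ≡ 1
      det≡2          : det A ≡ + 2 ⟨mod 4 ⟩
      V0-line        : HasDim (V0bar A) 1
      V00-trivial    : HasDim (V00bar A) 0
      q-nonvanishing : QNonvanishing A

  record IsotropicRadical (A : Mat n) : Set where
    field
      det≡0            : det A ≡ 0ℤ ⟨mod 4 ⟩
      radicalDim       : ℕ
      radicalDim≥1     : 1 ≤ radicalDim
      V0-dim           : HasDim (V0bar A) radicalDim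
      -- rules out case (2) when V̄₀ is a line
      2≤radicalDim⊎vanishes : 2 ≤ radicalDim ⊎ QVanishes A
      isotropicDim     : ℕ
      isotropicDim≥1   : 1 ≤ isotropicDim
      V00-dim          : HasDim (V00bar A) isotropicDim

  data Classification (A : Mat n) : Set where
    nonsingular : Nonsingular A → Classification A
    anisotropic : AnisotropicRadical A → Classification A
    isotropic   : IsotropicRadical A → Classification A

  record SameRadical (A : Mat n) (B : Mat m) : Set where
    field
      V0-length    : length (V0bar A) ≡ length (V0bar B)
      V00-length   : length (V00bar A) ≡ length (V00bar B)
      vanishes     : QVanishes B → QVanishes A
      nonvanishing : QNonvanishing B → QNonvanishing A

  classification-transfer : {A : Mat n} {B : Mat m} (σ : ℤ) → σ ≡ 1ℤ ⊎ σ ≡ -1ℤ → n % 2 ≡ m % 2 →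
    hyperbolicSign n ≡ σ * hyperbolicSign m → det A ≡ σ * det B ⟨mod 4 ⟩ → SameRadical A B →
    Classification B → Classification A
  classification-transfer σ σ-unit parity sign det≡ same (nonsingular N) = nonsingular record
    { size-even   = trans parity size-even
    ; det≡sign    = mod-trans det≡ (mod-trans (mod-* (mod-refl {a = σ}) det≡sign) (mod-reflexive (sym sign)))
    ; V0-trivial  = trans V0-length V0-trivial
    ; V00-trivial = trans V00-length V00-trivial
    ; q-vanishes  = vanishes q-vanishes
    }
    where
    open Nonsingular N
    open SameRadical same
  classification-transfer σ σ-unit parity sign det≡ same (anisotropic Z) = anisotropic record
    { size-odd       = trans parity size-odd
    ; det≡2          = mod-trans det≡ (mod-trans (mod-* (mod-refl {a = σ}) det≡2) (unit*2≡2 σ-unit))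
    ; V0-line        = trans V0-length V0-line
    ; V00-trivial    = trans V00-length V00-trivial
    ; q-nonvanishing = nonvanishing q-nonvanishing
    }
    where
    open AnisotropicRadical Z
    open SameRadical same
  classification-transfer σ σ-unit parity sign det≡ same (isotropic I) = isotropic record
    { det≡0            = mod-trans det≡ (mod-trans (mod-* (mod-refl {a = σ}) det≡0) (mod-reflexive (ℤP.*-zeroʳ σ)))
    ; radicalDim       = radicalDim
    ; radicalDim≥1     = radicalDim≥1
    ; V0-dim           = trans V0-length V0-dim
    ; 2≤radicalDim⊎vanishes = Sum.map₂ vanishes 2≤radicalDim⊎vanishes
    ; isotropicDim     = isotropicDim
    ; isotropicDim≥1   = isotropicDim≥1
    ; V00-dim          = trans V00-length V00-dim
    }
    where
    open IsotropicRadical I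
    open SameRadical same

  module _ (A : Mat (suc n)) (sym-A : Symmetric A) (even-A : EvenDiagonal A)
           (row-even : ∀ j → Abar A zero j ≡ false) where

    private
      α : ℤ
      α = proj₁ (even-quotient (A zero zero) (even-A zero))
      open EvenFirstRow A sym-A even-A row-even {α} (proj₂ (even-quotient (A zero zero) (even-A zero)))

    classify-evenFirstRow : Classification (minor A zero) → Classification A
    classify-evenFirstRow C-class with bit α in α≡
    ... | false = isotropic (radical C-class)
      where
      open Isotropic α≡
      radical : Classification (minor A zero) → IsotropicRadical A
      radical (nonsingular N) = record
        { det≡0 = det≡0
        ; radicalDim = 1 ; radicalDim≥1 = s≤s z≤n ; V0-dim = doubled 0 V0-double N.V0-trivial
        ; 2≤radicalDim⊎vanishes = inj₂ (q-vanishes N.q-vanishes)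
        ; isotropicDim = 1 ; isotropicDim≥1 = s≤s z≤n ; V00-dim = doubled 0 V00-double N.V00-trivial }
        where module N = Nonsingular N
      radical (anisotropic Z) = record
        { det≡0 = det≡0
        ; radicalDim = 2 ; radicalDim≥1 = s≤s z≤n ; V0-dim = doubled 1 V0-double Z.V0-line
        ; 2≤radicalDim⊎vanishes = inj₁ ℕP.≤-refl
        ; isotropicDim = 1 ; isotropicDim≥1 = s≤s z≤n ; V00-dim = doubled 0 V00-double Z.V00-trivial }
        where module Z = AnisotropicRadical Z
      radical (isotropic I) = record
        { det≡0 = det≡0
        ; radicalDim = suc I.radicalDim ; radicalDim≥1 = s≤s z≤n ; V0-dim = doubled I.radicalDim V0-double I.V0-dim
        ; 2≤radicalDim⊎vanishes = inj₁ (s≤s I.radicalDim≥1)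
        ; isotropicDim = suc I.isotropicDim ; isotropicDim≥1 = s≤s z≤n
        ; V00-dim = doubled I.isotropicDim V00-double I.V00-dim }
        where module I = IsotropicRadical I
    ... | true = classify C-class
      where
      open Anisotropic α≡
      classify : Classification (minor A zero) → Classification A
      classify (nonsingular N) = anisotropic record
        { size-odd = even⇒suc-odd n N.size-even
        ; det≡2 = mod-trans det≡2det (mod-trans (mod-* (mod-refl {a = + 2}) N.det≡sign)
                    (mod-trans (mod-reflexive (ℤP.*-comm (+ 2) (hyperbolicSign n))) (unit*2≡2 (hyperbolicSign-unit n))))
        ; V0-line = doubled 0 V0-double N.V0-trivial ; V00-trivial = trans V00≡V0 N.V0-trivial
        ; q-nonvanishing = q-nonvanishing }
        where module N = Nonsingular N
      classify (anisotropic Z) = isotropic record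
        { det≡0 = mod-trans det≡2det (mod-trans (mod-* (mod-refl {a = + 2}) Z.det≡2) (mod-by 1ℤ refl))
        ; radicalDim = 2 ; radicalDim≥1 = s≤s z≤n ; V0-dim = doubled 1 V0-double Z.V0-line
        ; 2≤radicalDim⊎vanishes = inj₁ ℕP.≤-refl
        ; isotropicDim = 1 ; isotropicDim≥1 = ℕP.≤-refl ; V00-dim = trans V00≡V0 Z.V0-line }
        where module Z = AnisotropicRadical Z
      classify (isotropic I) = isotropic record
        { det≡0 = mod-trans det≡2det (mod-* (mod-refl {a = + 2}) I.det≡0)
        ; radicalDim = suc I.radicalDim ; radicalDim≥1 = s≤s z≤n ; V0-dim = doubled I.radicalDim V0-double I.V0-dim
        ; 2≤radicalDim⊎vanishes = inj₁ (s≤s I.radicalDim≥1)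
        ; isotropicDim = I.radicalDim ; isotropicDim≥1 = I.radicalDim≥1 ; V00-dim = trans V00≡V0 I.V0-dim }
        where module I = IsotropicRadical I

  classify-oddPivot : (A : Mat (suc (suc n))) (sym-A : Symmetric A) (even-A : EvenDiagonal A) → Abar A 0F 1F ≡ true →
    Classification (schur A) → Classification A
  classify-oddPivot A sym-A even-A pivot-odd =
    classification-transfer -1ℤ (inj₂ refl) refl (sym (ℤP.-1*i≡-i _))
      (mod-trans det≡-det-schur (mod-reflexive (sym (ℤP.-1*i≡-i (det (schur A))))))
      record { V0-length = V0-same ; V00-length = V00-same ; vanishes = q-vanishes ; nonvanishing = q-nonvanishing }
    where
    open OddPivot A sym-A even-A pivot-odd

  classify-conjugate : (A : Mat n) (c d : Fin n) → Classification (conjugate A c d) → Classification A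
  classify-conjugate A c d =
    classification-transfer 1ℤ (inj₁ refl) refl (sym (ℤP.*-identityˡ _))
      (mod-reflexive (trans (sym (det-conjugate A c d)) (sym (ℤP.*-identityˡ (det (conjugate A c d))))))
      record { V0-length = sym V0-same ; V00-length = sym V00-same ; vanishes = q-vanishes ; nonvanishing = q-nonvanishing }
    where
    open Transposition A c d

  classify : (A : Mat n) → Symmetric A → EvenDiagonal A → Classification A
  classify {zero} A _ _ = nonsingular record
    { size-even = refl ; det≡sign = mod-refl ; V0-trivial = refl ; V00-trivial = refl ; q-vanishes = λ _ _ → refl }
  classify {suc n} A sym-A even-A with FinP.any? (λ j → Abar A zero j BoolP.≟ true)
  ... | no no-odd-entry = classify-evenFirstRow A sym-A even-A (λ j → BoolP.¬-not (λ odd → no-odd-entry (j , odd)))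
          (classify (minor A zero) (minor-symmetric A sym-A) (minor-evenDiagonal A even-A))
  classify {suc n} A sym-A even-A | yes (zero , odd) =
    ⊥-elim (BoolP.not-¬ (even⇒bit≡false (A zero zero) (even-A zero)) odd)
  classify {suc zero} A sym-A even-A | yes (suc () , _)
  classify {suc (suc n)} A sym-A even-A | yes (suc j , odd) =
    classify-conjugate A 1F (suc j)
      (classify-oddPivot A′ sym-A′ even-A′ pivot-odd (classify (schur A′) schur-symmetric schur-evenDiagonal))
    where
    A′ : Mat (suc (suc n))
    A′ = conjugate A 1F (suc j)
    sym-A′ : Symmetric A′
    sym-A′ i k = sym-A (PC.transpose 1F (suc j) i) (PC.transpose 1F (suc j) k)
    even-A′ : EvenDiagonal A′
    even-A′ i = even-A (PC.transpose 1F (suc j) i)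
    pivot-odd : Abar A′ 0F 1F ≡ true
    pivot-odd = trans (cong₂ (λ a b → Abar A a b) (transpose-other {i = 1F} {j = suc j} (λ ()) (λ ()))
                                                  (transpose-matchˡ 1F (suc j)))
                      odd
    open OddPivot A′ sym-A′ even-A′ pivot-odd using (schur-symmetric; schur-evenDiagonal)

  module Consequences {n : ℕ} {A : Mat n} where

    rank-nonsingular : Nonsingular A → HasRank A n
    rank-nonsingular N = Equivalence.from (rank⇔ A (Nonsingular.V0-trivial N) n) (ℕP.+-identityʳ n)

    corank-unique : ∀ d r e → HasDim (V0bar A) d → HasRank A r → r ℕ.+ e ≡ n → d ≡ e
    corank-unique d r e V0-dim rank r+e≡n =
      ℕP.+-cancelˡ-≡ r d e (trans (Equivalence.to (rank⇔ A V0-dim r) rank) (sym r+e≡n))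

    corank-bound : ∀ d r e → HasDim (V0bar A) d → HasRank A r → r ℕ.+ e ≤ n → e ≤ d
    corank-bound d r e V0-dim rank r+e≤n =
      ℕP.+-cancelˡ-≤ r e d (subst (r ℕ.+ e ≤_) (sym (Equivalence.to (rank⇔ A V0-dim r) rank)) r+e≤n)

    full-rank⇒nonsingular : Classification A → HasRank A n → Nonsingular A
    full-rank⇒nonsingular (nonsingular N) full = N
    full-rank⇒nonsingular (anisotropic Z) full
      with () ← corank-unique 1 n 0 (AnisotropicRadical.V0-line Z) full (ℕP.+-identityʳ n)
    full-rank⇒nonsingular (isotropic I) full =
      ⊥-elim (ℕP.<⇒≢ I.radicalDim≥1 (sym (corank-unique I.radicalDim n 0 I.V0-dim full (ℕP.+-identityʳ n))))
      where module I = IsotropicRadical I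

    det-nonsingular : Nonsingular A → det A ≡ 1ℤ ⟨mod 4 ⟩ ⊎ det A ≡ -1ℤ ⟨mod 4 ⟩
    det-nonsingular N with hyperbolicSign-unit n
    ... | inj₁ sign≡1  = inj₁ (subst (λ s → det A ≡ s ⟨mod 4 ⟩) sign≡1 (Nonsingular.det≡sign N))
    ... | inj₂ sign≡-1 = inj₂ (subst (λ s → det A ≡ s ⟨mod 4 ⟩) sign≡-1 (Nonsingular.det≡sign N))

    det≡±1⇔full-rank : Classification A → (det A ≡ 1ℤ [mod 4 ] ⊎ det A ≡ -1ℤ [mod 4 ]) ⇔ HasRank A n
    det≡±1⇔full-rank class = mk⇔ (to class) λ full → Sum.map toMod toMod (det-nonsingular (full-rank⇒nonsingular class full))
      where
      to : Classification A → det A ≡ 1ℤ [mod 4 ] ⊎ det A ≡ -1ℤ [mod 4 ] → HasRank A n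
      to (nonsingular N) _      = rank-nonsingular N
      to (anisotropic Z) det≡±1 = ⊥-elim (±1≢2 (Sum.map fromMod fromMod det≡±1) (AnisotropicRadical.det≡2 Z))
      to (isotropic I)   det≡±1 = ⊥-elim (±1≢0 (Sum.map fromMod fromMod det≡±1) (IsotropicRadical.det≡0 I))

    QOnto : Set
    QOnto = (b : Bool) → ∃ λ v → InV0 A v ≡ true × q A v ≡ b

    corank-one⇒q-vanishes : IsotropicRadical A → HasRank A (n ∸ 1) → 1 ≤ n → QVanishes A
    corank-one⇒q-vanishes I rank 1≤n with IsotropicRadical.2≤radicalDim⊎vanishes I
    ... | inj₁ 2≤d    = ⊥-elim (ℕP.1+n≰n (subst (2 ≤_) radicalDim≡1 2≤d))
      where
      radicalDim≡1 : IsotropicRadical.radicalDim I ≡ 1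
      radicalDim≡1 = corank-unique _ (n ∸ 1) 1 (IsotropicRadical.V0-dim I) rank (ℕP.m∸n+n≡m 1≤n)
    ... | inj₂ vanishes = vanishes

    det≡2⇔anisotropic : Classification A → (det A ≡ + 2 [mod 4 ]) ⇔ (n % 2 ≡ 1 × HasRank A (n ∸ 1) × QOnto)
    det≡2⇔anisotropic class = mk⇔ (to class) (from class)
      where
      to : Classification A → det A ≡ + 2 [mod 4 ] → n % 2 ≡ 1 × HasRank A (n ∸ 1) × QOnto
      to (nonsingular N) det≡2 = ⊥-elim (±1≢2 (det-nonsingular N) (fromMod det≡2))
      to (isotropic I)   det≡2 = ⊥-elim (2≢0 (fromMod det≡2) (IsotropicRadical.det≡0 I))
      to (anisotropic Z) _     =
        size-odd , Equivalence.from (rank⇔ A V0-line (n ∸ 1)) (ℕP.m∸n+n≡m (odd⇒positive size-odd)) , q-onto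
        where
        open AnisotropicRadical Z
        q-onto : QOnto
        q-onto false = zeroVec , InV0-zero A , q-zero A
        q-onto true  = q-nonvanishing
      from : Classification A → n % 2 ≡ 1 × HasRank A (n ∸ 1) × QOnto → det A ≡ + 2 [mod 4 ]
      from (nonsingular N) (size-odd , _) with () ← trans (sym (Nonsingular.size-even N)) size-odd
      from (anisotropic Z) _ = toMod (AnisotropicRadical.det≡2 Z)
      from (isotropic I) (size-odd , rank , q-onto)
        with v , v∈V0 , qv≡1 ← q-onto true
        with () ← trans (sym qv≡1) (corank-one⇒q-vanishes I rank (odd⇒positive size-odd) v v∈V0)

    det≡0⇔isotropic : Classification A → (det A ≡ 0ℤ [mod 4 ]) ⇔ (∃ λ k → 1 ≤ k × HasDim (V00bar A) k)
    det≡0⇔isotropic class = mk⇔ (to class) (from class)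
      where
      to : Classification A → det A ≡ 0ℤ [mod 4 ] → ∃ λ k → 1 ≤ k × HasDim (V00bar A) k
      to (nonsingular N) det≡0 = ⊥-elim (±1≢0 (det-nonsingular N) (fromMod det≡0))
      to (anisotropic Z) det≡0 = ⊥-elim (2≢0 (AnisotropicRadical.det≡2 Z) (fromMod det≡0))
      to (isotropic I)   _     = I.isotropicDim , I.isotropicDim≥1 , I.V00-dim
        where module I = IsotropicRadical I
      from : Classification A → (∃ λ k → 1 ≤ k × HasDim (V00bar A) k) → det A ≡ 0ℤ [mod 4 ]
      from (nonsingular N) (k , 1≤k , V00-dim) =
        ⊥-elim (ℕP.<⇒≢ 1≤k (2^-injective (trans (sym (Nonsingular.V00-trivial N)) V00-dim)))
      from (anisotropic Z) (k , 1≤k , V00-dim) =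
        ⊥-elim (ℕP.<⇒≢ 1≤k (2^-injective (trans (sym (AnisotropicRadical.V00-trivial Z)) V00-dim)))
      from (isotropic I)   _ = toMod (IsotropicRadical.det≡0 I)

    corank≥2⇒det≡0 : Classification A → (∃ λ r → r ℕ.+ 2 ≤ n × HasRank A r) → det A ≡ 0ℤ [mod 4 ]
    corank≥2⇒det≡0 (nonsingular N) (r , r+2≤n , rank) with () ← corank-bound 0 r 2 (Nonsingular.V0-trivial N) rank r+2≤n
    corank≥2⇒det≡0 (anisotropic Z) (r , r+2≤n , rank) =
      ⊥-elim (ℕP.1+n≰n (corank-bound 1 r 2 (AnisotropicRadical.V0-line Z) rank r+2≤n))
    corank≥2⇒det≡0 (isotropic I)   _ = toMod (IsotropicRadical.det≡0 I)

    even-size : Classification A → n % 2 ≡ 0 →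
      (HasRank A n → det A ≡ hyperbolicSign n ⟨mod 4 ⟩) × ((∃ λ r → r < n × HasRank A r) → det A ≡ 0ℤ [mod 4 ])
    even-size class size-even = (λ full → Nonsingular.det≡sign (full-rank⇒nonsingular class full)) , deficient class
      where
      deficient : Classification A → (∃ λ r → r < n × HasRank A r) → det A ≡ 0ℤ [mod 4 ]
      deficient (nonsingular N) (r , r<n , rank)
        with () ← corank-bound 0 r 1 (Nonsingular.V0-trivial N) rank (subst (ℕ._≤ n) (ℕP.+-comm 1 r) r<n)
      deficient (anisotropic Z) _ with () ← trans (sym size-even) (AnisotropicRadical.size-odd Z)
      deficient (isotropic I)   _ = toMod (IsotropicRadical.det≡0 I)

open import Defs
open import Data.Bool using (Bool; true; false)
open import Data.Nat using (ℕ; _≤_; _<_; _+_; _∸_; _%_)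
open import Data.Integer using (+_; -1ℤ; 0ℤ; 1ℤ)
open import Data.Product using (Σ; _×_; ∃; _,_)
open import Data.Sum using (_⊎_)
open import Function.Bundles using (_⇔_)
open import Relation.Binary.PropositionalEquality using (_≡_)
open import Relation.Binary.PropositionalEquality using (refl)
open import Function using (_∘_)
open Arithmetic using (_≡_⟨mod_⟩; toMod)
open Mod4Classification

corollary1p3 : (n : ℕ) (A : Mat n) → Symmetric A → EvenDiagonal A →
    (((det A ≡ 1ℤ [mod 4 ] ⊎ det A ≡ -1ℤ [mod 4 ]) ⇔ HasRank A n)
    × ((det A ≡ + 2 [mod 4 ]) ⇔ (n % 2 ≡ 1 × HasRank A (n ∸ 1) × ((b : Bool) → ∃ λ v → InV0 A v ≡ true × q A v ≡ b)))
    × ((det A ≡ 0ℤ [mod 4 ]) ⇔ (∃ λ k → 1 ≤ k × HasDim (V00bar A) k))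
    × ((∃ λ r → r + 2 ≤ n × HasRank A r) → det A ≡ 0ℤ [mod 4 ])
    × (n % 4 ≡ 0 → (HasRank A n → det A ≡ 1ℤ [mod 4 ]) × ((∃ λ r → r < n × HasRank A r) → det A ≡ 0ℤ [mod 4 ]))
    × (n % 4 ≡ 2 → (HasRank A n → det A ≡ -1ℤ [mod 4 ]) × ((∃ λ r → r < n × HasRank A r) → det A ≡ 0ℤ [mod 4 ])))
corollary1p3 n A sym-A even-A =
    det≡±1⇔full-rank class
  , det≡2⇔anisotropic class
  , det≡0⇔isotropic class
  , corank≥2⇒det≡0 class
  , (λ n%4≡0 → with-sign (hyperbolicSign≡1 n n%4≡0) (even-size class (%4⇒%2 n n%4≡0)))
  , (λ n%4≡2 → with-sign (hyperbolicSign≡-1 n n%4≡2) (even-size class (%4⇒%2 n n%4≡2)))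
  where
  open Consequences {n} {A}
  class : Classification A
  class = classify A sym-A even-A
  with-sign : ∀ {s} {X : Set} → hyperbolicSign n ≡ s →
    (HasRank A n → det A ≡ hyperbolicSign n ⟨mod 4 ⟩) × X → (HasRank A n → det A ≡ s [mod 4 ]) × X
  with-sign refl (full , deficient) = toMod ∘ full , deficient
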